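{- Let $H=L(r_1,\dots,r_m)$ be a truncated parallelogram. Then the subposet $\mathcal{I}(\mathbf{M}(H))$ of join-irreducible elements of $\mathbf{M}(H)$ is isomorphic to $\mathbf{F}(H)$.
   Context: Draw the regular hexagonal tiling so each hexagon has two vertical edges. For $r_1\ge\cdots\ge r_m\ge1$, $L(r_1,\dots,r_m)$ is the union of hexagons $h_{ij}$ ($1\le i\le m$, $1\le j\le r_i$), where $h_{i,j+1}$ shares the right vertical edge of $h_{i,j}$ and $h_{i+1,1}$ shares the upper-left slanted edge of $h_{i,1}$. Vertices are properly 2-colored so that the lowest vertex of each hexagon is white. $\mathbf{F}(H)$ is the poset on hexagons with $h_{ij}\preceq h_{kl}$ iff $i\le k$ and $j\le l$. A 1-factor is a perfect matching, $\mathcal{M}(H)$ the set of them; for $M\in\mathcal{M}(H)$ a cycle is $M$-alternating if its edges alternate in/out of $M$, and proper if each of its edges in $M$ goes from white to black end-vertex along the clockwise orientation. $\vec Z(H)$ has vertex set $\mathcal{M}(H)$ and an arc $M_1\to M_2$ when $M_1\oplus M_2$ bounds a hexagon and is a proper $M_1$-alternating cycle; $\mathbf{M}(H)$ is the poset with $M_1\preceq M_2$ iff $\vec Z(H)$ has a directed path from $M_2$ to $M_1$ (a finite distributive lattice). An element $x$ of a lattice is join-irreducible if $x$ is not the least element and cannot be written as $x=y\vee z$ with $y\prec x$ and $z\prec x$. -}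

module Defs where

open import Data.Bool using (Bool; true; false; _xor_)
open import Data.Nat using (ℕ; suc; _≤_)
open import Data.Integer using (ℤ; +_; _-_)
open import Data.Fin using (Fin; toℕ)
open import Data.Product using (Σ; ∃; _×_; _,_; proj₁)
open import Data.Sum using (_⊎_)
open import Data.Empty using (⊥)
open import Data.List using (List; []; _∷_; map)
open import Data.List.Membership.Propositional using (_∈_)
open import Data.List.Relation.Unary.All using (All)
open import Relation.Nullary using (¬_)
open import Relation.Binary.PropositionalEquality using (_≡_; _≢_)
open import Relation.Binary.Construct.Closure.ReflexiveTransitive using (Star)

-- Hexagonal tiling with two vertical edges per hexagon.
-- Hexagons are indexed by (a , b) ∈ ℤ × ℤ: (a , b+1) is the right
-- neighbour and (a+1 , b) the upper-left neighbour of (a , b)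
-- (so (a+1 , b+1) is the upper-right neighbour).
-- Every vertex of the tiling is either the lowest vertex of exactly one
-- hexagon (white) or the highest vertex of exactly one hexagon (black).
--   white a b = lowest vertex of hexagon (a , b)
--   black a b = highest vertex of hexagon (a , b)
-- Vertices of hexagon (a , b), clockwise from the top:
--   top = black a b, upper-right = white (a+1) (b+1),
--   lower-right = black (a-1) b, bottom = white a b,
--   lower-left = black (a-1) (b-1), upper-left = white (a+1) b.

data Vtx : Set where
  white : ℤ → ℤ → Vtx
  black : ℤ → ℤ → Vtx

-- Each white vertex white a b has three neighbours:
--   d1 : black (a-1) b,  d2 : black (a-1) (b-1),  d3 : black (a-2) (b-1).
data Dir : Set where
  d1 d2 d3 : Dir

-- An edge is given (canonically) by its white end and a direction.
record Edge : Set where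
  constructor edge
  field
    wa wb : ℤ
    dir   : Dir
open Edge public

blackEnd : Edge → ℤ × ℤ
blackEnd (edge a b d1) = (a - + 1 , b)
blackEnd (edge a b d2) = (a - + 1 , b - + 1)
blackEnd (edge a b d3) = (a - + 2 , b - + 1)

Incident : Vtx → Edge → Set
Incident (white a b) e = (wa e , wb e) ≡ (a , b)
Incident (black a b) e = blackEnd e ≡ (a , b)

hexVertices : ℤ → ℤ → List Vtx
hexVertices a b =
  black a b ∷ white (a Data.Integer.+ + 1) (b Data.Integer.+ + 1) ∷ black (a - + 1) b ∷
  white a b ∷ black (a - + 1) (b - + 1) ∷ white (a Data.Integer.+ + 1) b ∷ []

record OEdge : Set where
  constructor oedge
  field
    oe        : Edge
    whiteTail : Bool
open OEdge public

-- Boundary of hexagon (a , b) oriented clockwise, starting at the top.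
clockwise : ℤ → ℤ → List OEdge
clockwise a b =
  oedge (edge (a Data.Integer.+ + 1) (b Data.Integer.+ + 1) d2) false ∷  -- top → upper-right
  oedge (edge (a Data.Integer.+ + 1) (b Data.Integer.+ + 1) d3) true  ∷  -- upper-right → lower-right
  oedge (edge a b d1) false ∷                                            -- lower-right → bottom
  oedge (edge a b d2) true  ∷                                            -- bottom → lower-left
  oedge (edge (a Data.Integer.+ + 1) b d3) false ∷                       -- lower-left → upper-left
  oedge (edge (a Data.Integer.+ + 1) b d1) true  ∷ []                    -- upper-left → top

hexEdges : ℤ → ℤ → List Edge
hexEdges a b = map oe (clockwise a b)

cyclicPairs : {A : Set} → List A → List (A × A)
cyclicPairs [] = []
cyclicPairs {A} (x ∷ xs) = go (x ∷ xs)
  where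
  go : List A → List (A × A)
  go [] = []
  go (y ∷ []) = (y , x) ∷ []
  go (y ∷ z ∷ zs) = (y , z) ∷ go (z ∷ zs)

ProperAlternatingHex : (Edge → Bool) → ℤ → ℤ → Set
ProperAlternatingHex M a b =
  All (λ p → M (oe (proj₁ p)) ≢ M (oe (Data.Product.proj₂ p))) (cyclicPairs (clockwise a b))
  × All (λ o → M (oe o) ≡ true → whiteTail o ≡ true) (clockwise a b)

-- A subgraph H given as a union of hexagons (predicate on ℤ × ℤ).

Region : Set₁
Region = ℤ → ℤ → Set

EdgeOf : Region → Edge → Set
EdgeOf H e = Σ ℤ λ a → Σ ℤ λ b → H a b × e ∈ hexEdges a b

VertexOf : Region → Vtx → Set
VertexOf H v = Σ ℤ λ a → Σ ℤ λ b → H a b × v ∈ hexVertices a b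

IsPerfectMatching : Region → (Edge → Bool) → Set
IsPerfectMatching H M =
  (∀ e → M e ≡ true → EdgeOf H e) ×
  (∀ v → VertexOf H v →
     Σ Edge λ e → M e ≡ true × Incident v e ×
       (∀ e′ → M e′ ≡ true → Incident v e′ → e′ ≡ e))

record PM (H : Region) : Set where
  constructor pm
  field
    mat  : Edge → Bool
    isPM : IsPerfectMatching H mat
open PM public

_≈M_ : {H : Region} → PM H → PM H → Set
M₁ ≈M M₂ = ∀ e → mat M₁ e ≡ mat M₂ e

Arc : {H : Region} → PM H → PM H → Set
Arc M₁ M₂ = Σ ℤ λ a → Σ ℤ λ b →
  ProperAlternatingHex (mat M₁) a b ×
  (∀ e → (mat M₁ e xor mat M₂ e ≡ true → e ∈ hexEdges a b) ×
         (e ∈ hexEdges a b → mat M₁ e xor mat M₂ e ≡ true))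

-- a step of a directed path (vertices identified up to ≈M)
Step : {H : Region} → PM H → PM H → Set
Step M₁ M₂ = M₁ ≈M M₂ ⊎ Arc M₁ M₂

_⪯M_ : {H : Region} → PM H → PM H → Set
M₁ ⪯M M₂ = Star Step M₂ M₁

module Order {A : Set} (_≈_ : A → A → Set) (_≤_ : A → A → Set) where
  _<_ : A → A → Set
  x < y = x ≤ y × ¬ (x ≈ y)

  IsLeast : A → Set
  IsLeast x = ∀ y → x ≤ y

  IsJoin : A → A → A → Set
  IsJoin y z x = y ≤ x × z ≤ x × (∀ u → y ≤ u → z ≤ u → x ≤ u)

  JoinIrreducible : A → Set
  JoinIrreducible x =
    ¬ IsLeast x × (∀ y z → IsJoin y z x → y < x → z < x → ⊥)

JoinIrreducibleM : {H : Region} → PM H → Set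
JoinIrreducibleM {H} = Order.JoinIrreducible (_≈M_ {H}) (_⪯M_ {H})

-- Truncated parallelogram L(r₁,…,r_m), rows indexed by Fin m
-- (row i : Fin m is row toℕ i + 1), r : Fin m → ℕ.

FElem : (m : ℕ) → (Fin m → ℕ) → Set
FElem m r = Σ (Fin m) λ i → Σ ℕ λ j → 1 ≤ j × j ≤ r i

_⪯F_ : {m : ℕ} {r : Fin m → ℕ} → FElem m r → FElem m r → Set
(i , j , _) ⪯F (k , l , _) = toℕ i ≤ toℕ k × j ≤ l

L : (m : ℕ) → (Fin m → ℕ) → Region
L m r a b = Σ (FElem m r) λ h →
  a ≡ + suc (toℕ (proj₁ h)) × b ≡ + proj₁ (Data.Product.proj₂ h)

-- In a perfect matching of L(r) each row of hexagons contains exactly one matched vertical edge,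
-- and all other edges are forced by these. If the edge in row i closes the first c_i hexagons,
-- then c_1 ≥ c_2 ≥ ⋯, so perfect matchings correspond to the order ideals {h_ij : j ≤ c_i} of
-- F(H). An arc of Z⃗(H) at a hexagon removes exactly that (maximal) hexagon from the ideal, and
-- every smaller ideal is reached by such steps; hence 𝐌(H) is isomorphic to the lattice of ideals
-- of F(H). There, as in Birkhoff's theorem, the join-irreducibles are the principal ideals ⟨h⟩:
-- below ⟨h⟩ every other ideal misses h, and any other nonempty ideal is the join of the principal
-- ideal of the last hexagon of its top nonempty row and of itself with that hexagon removed.

module Submission where

open import Defs
open import Data.Bool using (Bool; true; false; _∧_; _xor_)
open import Data.Nat using (ℕ; zero; suc; _≤_; _<_; z≤n; s≤s; _≟_; _≤?_; _<?_; _+_; _∸_; _≡ᵇ_; pred; >-nonZero)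
open import Data.Nat.Properties
open import Data.Fin using (Fin; toℕ; fromℕ<) renaming (zero to fz; suc to fs)
import Data.Fin.Properties as FP
open import Data.Integer using (+_; -[1+_]) renaming (_+_ to _+ℤ_)
open import Data.Product using (Σ; _×_; _,_; proj₁; proj₂)
open import Data.Sum using (_⊎_; inj₁; inj₂)
open import Data.Empty using (⊥; ⊥-elim)
open import Data.List using ([]; _∷_)
open import Data.List.Relation.Unary.All using ([]; _∷_)
open import Data.List.Relation.Unary.Any using (here; there)
open import Data.List.Membership.Propositional using (_∈_)
open import Relation.Nullary using (¬_; Dec; yes; no; does)
open import Relation.Nullary.Decidable using (dec-true; decidable-stable)
open import Function using (_∘_; case_of_; _⇔_; mk⇔; Equivalence)
open import Relation.Binary using (tri<; tri≈; tri>)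
open import Relation.Binary.PropositionalEquality
open import Relation.Binary.Construct.Closure.ReflexiveTransitive using (Star; ε; _◅_; _◅◅_)

module OrderEquivalence
  {A B : Set} {_≈ᴬ_ _≤ᴬ_ : A → A → Set} {_≈ᴮ_ _≤ᴮ_ : B → B → Set}
  (to : A → B) (from : B → A)
  (to-mono : ∀ {x y} → x ≤ᴬ y → to x ≤ᴮ to y)
  (to-reflects : ∀ {x y} → to x ≤ᴮ to y → x ≤ᴬ y)
  (to-cong : ∀ {x y} → x ≈ᴬ y → to x ≈ᴮ to y)
  (to-injective : ∀ {x y} → to x ≈ᴮ to y → x ≈ᴬ y)
  (to-from : ∀ b → to (from b) ≈ᴮ b)
  (≈ᴮ-sym : ∀ {x y} → x ≈ᴮ y → y ≈ᴮ x)
  (≈ᴮ-trans : ∀ {x y z} → x ≈ᴮ y → y ≈ᴮ z → x ≈ᴮ z)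
  (≈ᴮ⇒≤ᴮ : ∀ {x y} → x ≈ᴮ y → x ≤ᴮ y)
  (≤ᴮ-trans : ∀ {x y z} → x ≤ᴮ y → y ≤ᴮ z → x ≤ᴮ z)
  where

  module A = Order _≈ᴬ_ _≤ᴬ_
  module B = Order _≈ᴮ_ _≤ᴮ_

  ≤-to-from : ∀ b → b ≤ᴮ to (from b)
  ≤-to-from b = ≈ᴮ⇒≤ᴮ (≈ᴮ-sym (to-from b))

  to-from-≤ : ∀ b → to (from b) ≤ᴮ b
  to-from-≤ b = ≈ᴮ⇒≤ᴮ (to-from b)

  to-joinIrreducible : ∀ {a} → A.JoinIrreducible a → B.JoinIrreducible (to a)
  to-joinIrreducible {a} (notLeast , irreducible) =
    (λ least → notLeast λ a′ → to-reflects (least (to a′))) ,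
    λ y z (y≤ , z≤ , lub) (_ , y≉) (_ , z≉) →
      irreducible (from y) (from z)
        (below y≤ , below z≤ , λ u y≤u z≤u → to-reflects (lub (to u) (above y≤u) (above z≤u)))
        (below y≤ , unequal y≉) (below z≤ , unequal z≉)
    where
    below : ∀ {y} → y ≤ᴮ to a → from y ≤ᴬ a
    below y≤ = to-reflects (≤ᴮ-trans (to-from-≤ _) y≤)
    above : ∀ {y u} → from y ≤ᴬ u → y ≤ᴮ to u
    above y≤u = ≤ᴮ-trans (≤-to-from _) (to-mono y≤u)
    unequal : ∀ {y} → ¬ (y ≈ᴮ to a) → ¬ (from y ≈ᴬ a)
    unequal y≉ y≈ = y≉ (≈ᴮ-trans (≈ᴮ-sym (to-from _)) (to-cong y≈))

  from-joinIrreducible : ∀ {b} → B.JoinIrreducible b → A.JoinIrreducible (from b)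
  from-joinIrreducible {b} (notLeast , irreducible) =
    (λ least → notLeast λ b′ → ≤ᴮ-trans (≤-to-from b) (≤ᴮ-trans (to-mono (least (from b′))) (to-from-≤ b′))) ,
    λ y z (y≤ , z≤ , lub) (_ , y≉) (_ , z≉) →
      irreducible (to y) (to z)
        (below y≤ , below z≤ , λ u y≤u z≤u →
          ≤ᴮ-trans (≤-to-from b) (≤ᴮ-trans (to-mono (lub (from u) (above y≤u) (above z≤u))) (to-from-≤ u)))
        (below y≤ , unequal y≉) (below z≤ , unequal z≉)
    where
    below : ∀ {y} → y ≤ᴬ from b → to y ≤ᴮ b
    below y≤ = ≤ᴮ-trans (to-mono y≤) (to-from-≤ b)
    above : ∀ {y u} → to y ≤ᴮ u → y ≤ᴬ from u
    above y≤u = to-reflects (≤ᴮ-trans y≤u (≤-to-from _))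
    unequal : ∀ {y} → ¬ (y ≈ᴬ from b) → ¬ (to y ≈ᴮ b)
    unequal y≉ y≈ = y≉ (to-injective (≈ᴮ-trans y≈ (≈ᴮ-sym (to-from b))))

true≢false : true ≢ false
true≢false ()

≢true⇒≡false : ∀ {x} → x ≢ true → x ≡ false
≢true⇒≡false {true} n = ⊥-elim (n refl)
≢true⇒≡false {false} _ = refl

does-true⇒ : ∀ {A : Set} (d : Dec A) → does d ≡ true → A
does-true⇒ (yes a) _ = a

∧-true⇒ˡ : ∀ x y → (x ∧ y) ≡ true → x ≡ true
∧-true⇒ˡ true y _ = refl
∧-true⇒ʳ : ∀ x y → (x ∧ y) ≡ true → y ≡ true
∧-true⇒ʳ true y e = e
∧-true : ∀ {x y} → x ≡ true → y ≡ true → (x ∧ y) ≡ true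
∧-true refl refl = refl

xor-split : ∀ {u v} → (u xor v) ≡ true → u ≡ true ⊎ v ≡ true
xor-split {true} _ = inj₁ refl
xor-split {false} e = inj₂ e

xor-ne : ∀ {u v} → (u xor v) ≡ true → u ≡ v → ⊥
xor-ne {true} {true} () refl
xor-ne {false} {false} () refl

alternate-true : ∀ {x y : Bool} → x ≡ false → x ≢ y → y ≡ true
alternate-true {y = true} _ _ = refl
alternate-true {y = false} refl n = ⊥-elim (n refl)

blackTail⇒unmatched : ∀ {x : Bool} → (x ≡ true → false ≡ true) → x ≡ false
blackTail⇒unmatched f = ≢true⇒≡false (λ h → true≢false (sym (f h)))

1≰0 : ¬ 1 ≤ 0
1≰0 ()

+n+1 : ∀ n → + n +ℤ + 1 ≡ + suc n
+n+1 n = cong +_ (+-comm n 1)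

lookupℕ : (m : ℕ) → (Fin m → ℕ) → ℕ → ℕ
lookupℕ zero r i = 0
lookupℕ (suc m) r zero = r fz
lookupℕ (suc m) r (suc i) = lookupℕ m (λ x → r (fs x)) i

lookupℕ-toℕ : ∀ m (r : Fin m → ℕ) (f : Fin m) → lookupℕ m r (toℕ f) ≡ r f
lookupℕ-toℕ (suc m) r fz = refl
lookupℕ-toℕ (suc m) r (fs f) = lookupℕ-toℕ m (λ x → r (fs x)) f

lookupℕ-≥ : ∀ m (r : Fin m → ℕ) i → m ≤ i → lookupℕ m r i ≡ 0
lookupℕ-≥ zero r i _ = refl
lookupℕ-≥ (suc m) r (suc i) (s≤s le) = lookupℕ-≥ m (λ x → r (fs x)) i le

lookupℕ-pos⇒< : ∀ m (r : Fin m → ℕ) i → 1 ≤ lookupℕ m r i → i < m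
lookupℕ-pos⇒< zero r i ()
lookupℕ-pos⇒< (suc m) r zero _ = s≤s z≤n
lookupℕ-pos⇒< (suc m) r (suc i) h = s≤s (lookupℕ-pos⇒< m (λ x → r (fs x)) i h)

sumTo : ℕ → (ℕ → ℕ) → ℕ
sumTo zero f = 0
sumTo (suc n) f = f (suc n) + sumTo n f

sumTo-cong : ∀ n f g → (∀ k → 1 ≤ k → k ≤ n → f k ≡ g k) → sumTo n f ≡ sumTo n g
sumTo-cong zero f g h = refl
sumTo-cong (suc n) f g h = cong₂ _+_ (h (suc n) (s≤s z≤n) ≤-refl) (sumTo-cong n f g (λ k a b → h k a (≤-trans b (n≤1+n n))))

sumTo-decrement : ∀ n f g j → 1 ≤ j → j ≤ n → f j ≡ suc (g j) → (∀ k → k ≢ j → f k ≡ g k) → sumTo n f ≡ suc (sumTo n g)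
sumTo-decrement zero f g zero () z≤n e oth
sumTo-decrement (suc n) f g j 1≤j jn e oth with suc n ≟ j
... | yes refl = cong₂ _+_ e (sumTo-cong n f g (λ k _ kn → oth k (λ ke → 1+n≰n (subst (_≤ n) ke kn))))
... | no ne = trans (cong₂ _+_ (oth (suc n) ne) (sumTo-decrement n f g j 1≤j (≤-pred (≤∧≢⇒< jn (λ x → ne (sym x)))) e oth)) (+-suc _ _)

data ExactlyOne (x y z : Bool) : Set where
  first  : x ≡ true  → y ≡ false → z ≡ false → ExactlyOne x y z
  second : x ≡ false → y ≡ true  → z ≡ false → ExactlyOne x y z
  third  : x ≡ false → y ≡ false → z ≡ true  → ExactlyOne x y z

exactlyOne-¬₁₂ : ∀ {x y z} → ExactlyOne x y z → x ≡ true → y ≡ true → ⊥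
exactlyOne-¬₁₂ (first _ refl _) _ ()
exactlyOne-¬₁₂ (second refl _ _) ()
exactlyOne-¬₁₂ (third refl _ _) ()

exactlyOne-¬₁₃ : ∀ {x y z} → ExactlyOne x y z → x ≡ true → z ≡ true → ⊥
exactlyOne-¬₁₃ (first _ _ refl) _ ()
exactlyOne-¬₁₃ (second refl _ _) ()
exactlyOne-¬₁₃ (third refl _ _) ()

exactlyOne-¬₂₃ : ∀ {x y z} → ExactlyOne x y z → y ≡ true → z ≡ true → ⊥
exactlyOne-¬₂₃ (first _ refl _) ()
exactlyOne-¬₂₃ (second _ _ refl) _ ()
exactlyOne-¬₂₃ (third _ refl _) ()

sameDir : Dir → Dir → Bool
sameDir d1 d1 = true
sameDir d2 d2 = true
sameDir d3 d3 = true
sameDir _ _ = false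

sameDir⇒≡ : ∀ x y → sameDir x y ≡ true → x ≡ y
sameDir⇒≡ d1 d1 _ = refl
sameDir⇒≡ d2 d2 _ = refl
sameDir⇒≡ d3 d3 _ = refl
sameDir⇒≡ d1 d2 ()
sameDir⇒≡ d1 d3 ()
sameDir⇒≡ d2 d1 ()
sameDir⇒≡ d2 d3 ()
sameDir⇒≡ d3 d1 ()
sameDir⇒≡ d3 d2 ()

sameDir-refl : ∀ x → sameDir x x ≡ true
sameDir-refl d1 = refl
sameDir-refl d2 = refl
sameDir-refl d3 = refl

d1≢d2 : d1 ≢ d2
d1≢d2 ()
d1≢d3 : d1 ≢ d3
d1≢d3 ()
d2≢d1 : d2 ≢ d1
d2≢d1 ()
d2≢d3 : d2 ≢ d3
d2≢d3 ()
d3≢d1 : d3 ≢ d1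
d3≢d1 ()
d3≢d2 : d3 ≢ d2
d3≢d2 ()

-- The matched edge at the white vertex in column b of a strip between a row of length p and
-- the row of length q above it: the vertical edge closing the lower row, d1 in the columns where
-- the lower row sticks out beyond the upper one, and d2 elsewhere.
matchDir : ℕ → ℕ → ℕ → Dir
matchDir p q b with b ≟ suc p
... | yes _ = d3
... | no _ with q <? b | b ≤? p
...   | yes _ | yes _ = d1
...   | _ | _ = d2

matchDir-d3 : ∀ p q b → b ≡ suc p → matchDir p q b ≡ d3
matchDir-d3 p q b e with b ≟ suc p
... | yes _ = refl
... | no ne = ⊥-elim (ne e)

matchDir-d1 : ∀ p q b → q < b → b ≤ p → matchDir p q b ≡ d1
matchDir-d1 p q b h1 h2 with b ≟ suc p
... | yes refl = ⊥-elim (<-irrefl refl h2)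
... | no _ with q <? b | b ≤? p
... | yes _ | yes _ = refl
... | no n | _ = ⊥-elim (n h1)
... | yes _ | no n = ⊥-elim (n h2)

matchDir-d2-low : ∀ p q b → b ≤ q → q ≤ p → matchDir p q b ≡ d2
matchDir-d2-low p q b h1 h2 with b ≟ suc p
... | yes refl = ⊥-elim (<-irrefl refl (≤-trans h1 h2))
... | no _ with q <? b | b ≤? p
... | yes x | yes _ = ⊥-elim (<-irrefl refl (<-≤-trans x h1))
... | yes _ | no _ = refl
... | no _ | _ = refl

matchDir-d2-high : ∀ p q b → suc (suc p) ≤ b → matchDir p q b ≡ d2
matchDir-d2-high p q b h with b ≟ suc p
... | yes refl = ⊥-elim (<-irrefl refl h)
... | no _ with q <? b | b ≤? p
... | yes _ | yes x = ⊥-elim (<-irrefl refl (≤-trans (≤-trans (n≤1+n _) h) x))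
... | yes _ | no _ = refl
... | no _ | _ = refl

matchDir≡d3⇒ : ∀ p q b → matchDir p q b ≡ d3 → b ≡ suc p
matchDir≡d3⇒ p q b e with b ≟ suc p
... | yes x = x
... | no _ with q <? b | b ≤? p
... | yes _ | yes _ = ⊥-elim (d1≢d3 e)
... | yes _ | no _ = ⊥-elim (d2≢d3 e)
... | no _ | _ = ⊥-elim (d2≢d3 e)

matchDir≡d1⇒ : ∀ p q b → matchDir p q b ≡ d1 → q < b × b ≤ p
matchDir≡d1⇒ p q b e with b ≟ suc p
... | yes x = ⊥-elim (d3≢d1 e)
... | no _ with q <? b | b ≤? p
... | yes x | yes y = x , y
... | yes _ | no _ = ⊥-elim (d2≢d1 e)
... | no _ | _ = ⊥-elim (d2≢d1 e)

matchDir≡d2⇒ : ∀ p q b → matchDir p q b ≡ d2 → (b ≡ suc p → ⊥) × (q < b → b ≤ p → ⊥)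
matchDir≡d2⇒ p q b e with b ≟ suc p
... | yes x = ⊥-elim (d3≢d2 e)
... | no ne with q <? b | b ≤? p
... | yes x | yes y = ⊥-elim (d1≢d2 e)
... | yes _ | no n = ne , λ _ y → n y
... | no n | _ = ne , λ x _ → n x

matchDir-shrinkUpper : ∀ p b Y → suc b ≤ p → (matchDir p (suc b) Y ≡ matchDir p b Y → ⊥) → Y ≡ suc b
matchDir-shrinkUpper p b Y h n = cases (Y ≟ suc p) (Y ≤? b) (Y ≟ suc b) (Y ≤? p)
  where
  cases : Dec (Y ≡ suc p) → Dec (Y ≤ b) → Dec (Y ≡ suc b) → Dec (Y ≤ p) → Y ≡ suc b
  cases (yes e) _ _ _ = ⊥-elim (n (trans (matchDir-d3 p (suc b) Y e) (sym (matchDir-d3 p b Y e))))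
  cases (no _) (yes y≤b) _ _ = ⊥-elim (n (trans (matchDir-d2-low p (suc b) Y (≤-trans y≤b (n≤1+n b)) h) (sym (matchDir-d2-low p b Y y≤b (≤-trans (n≤1+n b) h)))))
  cases (no _) (no _) (yes e) _ = e
  cases (no _) (no y≰b) (no ne) (yes yp) =
    ⊥-elim (n (trans (matchDir-d1 p (suc b) Y (≤∧≢⇒< (≰⇒> y≰b) (λ e → ne (sym e))) yp) (sym (matchDir-d1 p b Y (≰⇒> y≰b) yp))))
  cases (no ne′) (no _) (no _) (no y≰p) = ⊥-elim (n (trans (matchDir-d2-high p (suc b) Y h2) (sym (matchDir-d2-high p b Y h2))))
    where
    h2 : suc (suc p) ≤ Y
    h2 = ≤∧≢⇒< (≰⇒> y≰p) (λ e → ne′ (sym e))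

matchDir-shrinkLower : ∀ b q Y → q ≤ b → (matchDir (suc b) q Y ≡ matchDir b q Y → ⊥) → Y ≡ suc b ⊎ Y ≡ suc (suc b)
matchDir-shrinkLower b q Y h n = cases (Y ≤? q) (Y ≤? b) (Y ≟ suc b) (Y ≟ suc (suc b))
  where
  cases : Dec (Y ≤ q) → Dec (Y ≤ b) → Dec (Y ≡ suc b) → Dec (Y ≡ suc (suc b)) → Y ≡ suc b ⊎ Y ≡ suc (suc b)
  cases (yes yq) _ _ _ = ⊥-elim (n (trans (matchDir-d2-low (suc b) q Y yq (≤-trans h (n≤1+n b))) (sym (matchDir-d2-low b q Y yq h))))
  cases (no yq) (yes yb) _ _ = ⊥-elim (n (trans (matchDir-d1 (suc b) q Y (≰⇒> yq) (≤-trans yb (n≤1+n b))) (sym (matchDir-d1 b q Y (≰⇒> yq) yb))))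
  cases (no _) (no _) (yes e) _ = inj₁ e
  cases (no _) (no _) (no _) (yes e) = inj₂ e
  cases (no _) (no y≰b) (no ne₁) (no ne₂) = ⊥-elim (n (trans (matchDir-d2-high (suc b) q Y h3) (sym (matchDir-d2-high b q Y (≤-trans (n≤1+n _) h3)))))
    where
    h2 : suc (suc b) ≤ Y
    h2 = ≤∧≢⇒< (≰⇒> y≰b) (λ e → ne₁ (sym e))
    h3 : suc (suc (suc b)) ≤ Y
    h3 = ≤∧≢⇒< h2 (λ e → ne₂ (sym e))

-- One horizontal strip of hexagons: whites 1 … nw (edges G b d), blacks 0 … nb (vertical edges
-- into the next strip U j), entered from below by the vertical edge at white suc p. A perfect
-- matching of the strip leaves it through exactly one vertical edge q ≤ p and agrees with matchDir p q.
module RowScan (G : ℕ → Dir → Bool) (U : ℕ → Bool) (nw nb p : ℕ)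
  (white-matched : ∀ b → 1 ≤ b → b ≤ nw → Σ Dir λ d → G b d ≡ true × (∀ d′ → G b d′ ≡ true → d′ ≡ d))
  (black-matched : ∀ j → j ≤ nb → ExactlyOne (G j d1) (G (suc j) d2) (U j))
  (no-d1-at-0 : G 0 d1 ≡ false)
  (vertical-below⇒ : ∀ b → 1 ≤ b → b ≤ nw → G b d3 ≡ true → b ≡ suc p)
  (vertical-below : suc p ≤ nw → G (suc p) d3 ≡ true)
  (p≤nb : p ≤ nb)
  (right-end : (nw ≡ suc nb × G nw d1 ≡ false) ⊎ (nw ≡ nb × p ≡ nb × G (suc nb) d2 ≡ false))
  where

  nb≤nw : nb ≤ nw
  nb≤nw = case right-end of λ
    { (inj₁ (e , _)) → subst (nb ≤_) (sym e) (n≤1+n nb)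
    ; (inj₂ (e , _)) → ≤-reflexive (sym e) }

  nw≤1+nb : nw ≤ suc nb
  nw≤1+nb = case right-end of λ
    { (inj₁ (e , _)) → ≤-reflexive e
    ; (inj₂ (e , _)) → subst (_≤ suc nb) (sym e) (n≤1+n nb) }

  p≤nw : p ≤ nw
  p≤nw = ≤-trans p≤nb nb≤nw

  white-unique : ∀ b → 1 ≤ b → b ≤ nw → ∀ d d′ → G b d ≡ true → G b d′ ≡ true → d ≡ d′
  white-unique b 1≤b b≤nw d d′ g g′ with white-matched b 1≤b b≤nw
  ... | _ , _ , unique = trans (unique d g) (sym (unique d′ g′))

  ¬d2-at-suc-p : G (suc p) d2 ≡ true → ⊥
  ¬d2-at-suc-p g with suc p ≤? nw
  ... | yes h = d3≢d2 (white-unique (suc p) (s≤s z≤n) h d3 d2 (vertical-below h) g)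
  ... | no n = case right-end of λ
    { (inj₁ (e , _)) → n (subst (suc p ≤_) (sym e) (s≤s p≤nb))
    ; (inj₂ (_ , refl , f)) → true≢false (trans (sym g) f) }

  D2Before : ℕ → Set
  D2Before j = ∀ j′ → j′ < j → G (suc j′) d2 ≡ true

  -- Scanning the blacks from the left, each is matched by d2 until the first vertical edge.
  firstVertical : ∀ k j → j + k ≡ p → D2Before j → Σ ℕ λ q → q ≤ p × D2Before q × U q ≡ true
  firstVertical k j e before with black-matched j (≤-trans (subst (j ≤_) e (m≤m+n j k)) p≤nb)
  ... | third _ _ u = j , subst (j ≤_) e (m≤m+n j k) , before , u
  ... | first g _ _ = ⊥-elim (¬d1 j (≤-trans (subst (j ≤_) e (m≤m+n j k)) p≤nw) before g)
    where
    ¬d1 : ∀ j → j ≤ nw → D2Before j → G j d1 ≡ true → ⊥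
    ¬d1 zero _ _ g = true≢false (trans (sym g) no-d1-at-0)
    ¬d1 (suc j′) j≤nw before g = d1≢d2 (white-unique (suc j′) (s≤s z≤n) j≤nw d1 d2 g (before j′ ≤-refl))
  ... | second _ g _ with k
  ...   | zero = ⊥-elim (¬d2-at-suc-p (subst (λ z → G (suc z) d2 ≡ true) (trans (sym (+-identityʳ j)) e) g))
  ...   | suc k′ = firstVertical k′ (suc j) (trans (sym (+-suc j k′)) e) before′
    where
    before′ : D2Before (suc j)
    before′ j′ lt with m≤n⇒m<n∨m≡n lt
    ... | inj₁ (s≤s lt′) = before j′ lt′
    ... | inj₂ refl = g

  q : ℕ
  q = proj₁ (firstVertical p 0 refl (λ _ ()))

  q≤p : q ≤ p
  q≤p = proj₁ (proj₂ (firstVertical p 0 refl (λ _ ())))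

  d2-before-q : D2Before q
  d2-before-q = proj₁ (proj₂ (proj₂ (firstVertical p 0 refl (λ _ ()))))

  vertical-q : U q ≡ true
  vertical-q = proj₂ (proj₂ (proj₂ (firstVertical p 0 refl (λ _ ()))))

  d1-between : ∀ b → q < b → b ≤ p → G b d1 ≡ true
  d1-between (suc b′) (s≤s q≤b′) b≤p with white-matched (suc b′) (s≤s z≤n) (≤-trans b≤p p≤nw)
  ... | d1 , g , _ = g
  ... | d3 , g , _ = ⊥-elim (1+n≰n (subst (_≤ p) (vertical-below⇒ (suc b′) (s≤s z≤n) (≤-trans b≤p p≤nw) g) b≤p))
  ... | d2 , g , _ with m≤n⇒m<n∨m≡n q≤b′
  ...   | inj₂ refl = ⊥-elim (exactlyOne-¬₂₃ (black-matched b′ b′≤nb) g vertical-q)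
    where b′≤nb = ≤-trans (≤-trans (n≤1+n b′) b≤p) p≤nb
  ...   | inj₁ lt = ⊥-elim (exactlyOne-¬₁₂ (black-matched b′ b′≤nb) (d1-between b′ lt (≤-trans (n≤1+n b′) b≤p)) g)
    where b′≤nb = ≤-trans (≤-trans (n≤1+n b′) b≤p) p≤nb

  -- Beyond suc p the matching is forced from the right end of the strip.
  d2-beyond′ : ∀ k b → b + k ≡ nw → suc (suc p) ≤ b → G b d2 ≡ true
  d2-beyond′ k b e h with white-matched b (≤-trans (s≤s z≤n) h) (subst (b ≤_) e (m≤m+n b k))
  ... | d2 , g , _ = g
  ... | d3 , g , _ = ⊥-elim (1+n≰n (subst (suc (suc p) ≤_) (vertical-below⇒ b (≤-trans (s≤s z≤n) h) (subst (b ≤_) e (m≤m+n b k)) g) h))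
  ... | d1 , g , _ with k
  ...   | zero = case right-end of λ
    { (inj₁ (_ , f)) → ⊥-elim (true≢false (trans (sym g) (subst (λ z → G z d1 ≡ false) (trans (sym e) (+-identityʳ b)) f)))
    ; (inj₂ (e₂ , e₃ , _)) →
      ⊥-elim (<⇒≱ (≤-trans (n≤1+n (suc p)) h) (≤-reflexive (trans (trans (sym (+-identityʳ b)) e) (trans e₂ (sym e₃))))) }
  ...   | suc k′ = ⊥-elim (exactlyOne-¬₁₂ (black-matched b b≤nb) g (d2-beyond′ k′ (suc b) (trans (sym (+-suc b k′)) e) (≤-trans h (n≤1+n b))))
    where
    b≤nb : b ≤ nb
    b≤nb = ≤-pred (≤-trans (≤-trans (s≤s (m≤m+n b k′)) (≤-reflexive (sym (+-suc b k′)))) (subst (_≤ suc nb) (sym e) nw≤1+nb))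

  d2-beyond : ∀ b → suc (suc p) ≤ b → b ≤ nw → G b d2 ≡ true
  d2-beyond b h b≤nw = d2-beyond′ (nw ∸ b) b (m+[n∸m]≡n b≤nw) h

  vertical-unique : ∀ j → j ≤ nb → U j ≡ true → j ≡ q
  vertical-unique j j≤nb u with <-cmp j q
  ... | tri≈ _ e _ = e
  ... | tri< lt _ _ = ⊥-elim (exactlyOne-¬₂₃ (black-matched j j≤nb) (d2-before-q j lt) u)
  ... | tri> _ _ gt with j ≤? p
  ...   | yes j≤p = ⊥-elim (exactlyOne-¬₁₃ (black-matched j j≤nb) (d1-between j gt j≤p) u)
  ...   | no j≰p = case right-end of λ
    { (inj₁ (e , _)) →
      ⊥-elim (exactlyOne-¬₂₃ (black-matched j j≤nb) (d2-beyond (suc j) (s≤s (≰⇒> j≰p)) (subst (suc j ≤_) (sym e) (s≤s j≤nb))) u)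
    ; (inj₂ (_ , refl , _)) → ⊥-elim (j≰p j≤nb) }

  matched-matchDir : ∀ b → 1 ≤ b → b ≤ nw → G b (matchDir p q b) ≡ true
  matched-matchDir b 1≤b b≤nw = matched (b ≟ suc p) (b ≤? q) (b ≤? p)
    where
    d2-upTo : ∀ b → 1 ≤ b → b ≤ q → G b d2 ≡ true
    d2-upTo (suc b′) _ b≤q = d2-before-q b′ b≤q
    matched : Dec (b ≡ suc p) → Dec (b ≤ q) → Dec (b ≤ p) → G b (matchDir p q b) ≡ true
    matched (yes refl) _ _ = subst (λ d → G b d ≡ true) (sym (matchDir-d3 p q b refl)) (vertical-below b≤nw)
    matched (no _) (yes b≤q) _ = subst (λ d → G b d ≡ true) (sym (matchDir-d2-low p q b b≤q q≤p)) (d2-upTo b 1≤b b≤q)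
    matched (no _) (no b≰q) (yes b≤p) = subst (λ d → G b d ≡ true) (sym (matchDir-d1 p q b (≰⇒> b≰q) b≤p)) (d1-between b (≰⇒> b≰q) b≤p)
    matched (no b≢) (no _) (no b≰p) = subst (λ d → G b d ≡ true) (sym (matchDir-d2-high p q b h)) (d2-beyond b h b≤nw)
      where
      h : suc (suc p) ≤ b
      h = ≤∧≢⇒< (≰⇒> b≰p) (λ e → b≢ (sym e))

module TruncatedParallelogram (m : ℕ) (r : Fin m → ℕ) (r-antitone : ∀ i k → toℕ i ≤ toℕ k → r k ≤ r i) (r-pos : ∀ i → 1 ≤ r i) where

  H : Region
  H = L m r

  -- ρ i is the length r_{i+1} of row i+1, and 0 beyond the last row.
  ρ : ℕ → ℕ
  ρ = lookupℕ m r

  ρ-toℕ : ∀ (f : Fin m) → ρ (toℕ f) ≡ r f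
  ρ-toℕ = lookupℕ-toℕ m r

  ρ-≥ : ∀ i → m ≤ i → ρ i ≡ 0
  ρ-≥ = lookupℕ-≥ m r

  ρ-fromℕ< : ∀ {i} (i<m : i < m) → ρ i ≡ r (fromℕ< i<m)
  ρ-fromℕ< i<m = trans (cong ρ (sym (FP.toℕ-fromℕ< i<m))) (ρ-toℕ _)

  ≤r⇒≤ρ : ∀ f {t j} → toℕ f ≡ t → j ≤ r f → j ≤ ρ t
  ≤r⇒≤ρ f refl = subst (_ ≤_) (sym (ρ-toℕ f))

  ρ-pos : ∀ i → i < m → 1 ≤ ρ i
  ρ-pos i i<m = subst (1 ≤_) (sym (ρ-fromℕ< i<m)) (r-pos _)

  ρ-pos⇒< : ∀ i → 1 ≤ ρ i → i < m
  ρ-pos⇒< = lookupℕ-pos⇒< m r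

  ρ-suc≤ : ∀ i → ρ (suc i) ≤ ρ i
  ρ-suc≤ i with suc i <? m
  ... | no n = subst (_≤ ρ i) (sym (ρ-≥ (suc i) (≮⇒≥ n))) z≤n
  ... | yes si<m = subst₂ _≤_ e1 e2 (r-antitone f g (subst₂ _≤_ (sym (FP.toℕ-fromℕ< i<m)) (sym (FP.toℕ-fromℕ< si<m)) (n≤1+n i)))
    where
    i<m : i < m
    i<m = <-trans (n<1+n i) si<m
    f = fromℕ< i<m
    g = fromℕ< si<m
    e1 : r g ≡ ρ (suc i)
    e1 = sym (ρ-fromℕ< si<m)
    e2 : r f ≡ ρ i
    e2 = sym (ρ-fromℕ< i<m)

  ρ-antitone : ∀ i k → i ≤ k → ρ k ≤ ρ i
  ρ-antitone i zero z≤n = ≤-refl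
  ρ-antitone i (suc k) le with m≤n⇒m<n∨m≡n le
  ... | inj₂ refl = ≤-refl
  ... | inj₁ (s≤s lt) = ≤-trans (ρ-suc≤ k) (ρ-antitone i k lt)

  -- Ideals of F(H)

  -- An order ideal of F(H), recorded by its row lengths: row i+1 keeps len (suc i) hexagons.
  -- The sentinel len 0 = ρ 0 lets row 1 be treated like the others.
  record Ideal : Set where
    constructor ideal
    field
      len      : ℕ → ℕ
      len-base : len 0 ≡ ρ 0
      len≤ρ    : ∀ i → len (suc i) ≤ ρ i
      len-suc≤ : ∀ i → len (suc i) ≤ len i
  open Ideal public using (len-base; len≤ρ; len-suc≤)

  _≈ᴵ_ : Ideal → Ideal → Set
  C ≈ᴵ C′ = ∀ k → Ideal.len C k ≡ Ideal.len C′ k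

  _≤ᴵ_ : Ideal → Ideal → Set
  C ≤ᴵ C′ = ∀ k → Ideal.len C k ≤ Ideal.len C′ k

  ≈ᴵ-antisym : ∀ {C C′} → C ≤ᴵ C′ → C′ ≤ᴵ C → C ≈ᴵ C′
  ≈ᴵ-antisym le ge k = ≤-antisym (le k) (ge k)

  ≈ᴵ-stable : ∀ {C C′} → ¬ ¬ (C ≈ᴵ C′) → C ≈ᴵ C′
  ≈ᴵ-stable ¬¬eq k = decidable-stable (_ ≟ _) (λ ne → ¬¬eq (λ eq → ne (eq k)))

  len-antitone′ : ∀ (C : Ideal) k n → Ideal.len C (n + k) ≤ Ideal.len C k
  len-antitone′ C k zero = ≤-refl
  len-antitone′ C k (suc n) = ≤-trans (len-suc≤ C (n + k)) (len-antitone′ C k n)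

  len-antitone : ∀ (C : Ideal) k k′ → k ≤ k′ → Ideal.len C k′ ≤ Ideal.len C k
  len-antitone C k k′ le = subst (λ z → Ideal.len C z ≤ Ideal.len C k) (m∸n+n≡m le) (len-antitone′ C k (k′ ∸ k))

  len-beyond : ∀ C i → ¬ i < m → Ideal.len C (suc i) ≡ 0
  len-beyond C i n = n≤0⇒n≡0 (subst (Ideal.len C (suc i) ≤_) (ρ-≥ i (≮⇒≥ n)) (len≤ρ C i))

  setAt : (ℕ → ℕ) → ℕ → ℕ → ℕ → ℕ
  setAt c a b k with k ≟ suc a
  ... | yes _ = b
  ... | no _ = c k

  setAt-same : ∀ c a b → setAt c a b (suc a) ≡ b
  setAt-same c a b with suc a ≟ suc a
  ... | yes _ = refl
  ... | no n = ⊥-elim (n refl)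

  setAt-other : ∀ c a b k → k ≢ suc a → setAt c a b k ≡ c k
  setAt-other c a b k ne with k ≟ suc a
  ... | yes e = ⊥-elim (ne e)
  ... | no _ = refl

  lowerRow : (C : Ideal) (a b : ℕ) → Ideal.len C (suc a) ≡ suc b → Ideal.len C (suc (suc a)) ≤ b → Ideal
  lowerRow C a b cs cq = ideal (setAt c a b) (len-base C) below-ρ antitone
    where
    c = Ideal.len C
    below-ρ : ∀ i → setAt c a b (suc i) ≤ ρ i
    below-ρ i with suc i ≟ suc a
    ... | yes refl = ≤-trans (n≤1+n b) (subst (_≤ ρ a) cs (len≤ρ C a))
    ... | no _ = len≤ρ C i
    antitone : ∀ k → setAt c a b (suc k) ≤ setAt c a b k
    antitone k with suc k ≟ suc a | k ≟ suc a
    ... | yes refl | yes e = ⊥-elim (1+n≢n (sym e))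
    ... | yes refl | no _ = ≤-trans (n≤1+n b) (subst (_≤ c a) cs (len-suc≤ C a))
    ... | no _ | yes refl = cq
    ... | no _ | no _ = len-suc≤ C k

  lowerRow-≤ᴵ : ∀ C a b cs cq → lowerRow C a b cs cq ≤ᴵ C
  lowerRow-≤ᴵ C a b cs cq k with k ≟ suc a
  ... | yes refl = subst (b ≤_) (sym cs) (n≤1+n b)
  ... | no _ = ≤-refl

  lowerRow-≉ : ∀ C a b cs cq → ¬ (lowerRow C a b cs cq ≈ᴵ C)
  lowerRow-≉ C a b cs cq eq = 1+n≰n (≤-reflexive (trans (sym cs) (trans (sym (eq (suc a))) (setAt-same (Ideal.len C) a b))))

  ≤ᴵ-lowerRow : ∀ {D} C a b cs cq → D ≤ᴵ C → Ideal.len D (suc a) ≤ b → D ≤ᴵ lowerRow C a b cs cq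
  ≤ᴵ-lowerRow C a b cs cq le row k with k ≟ suc a
  ... | yes refl = row
  ... | no ne = le k

  lowerRow-≤ᴵ⇒ : ∀ {D} C a b cs cq → lowerRow C a b cs cq ≤ᴵ D → Ideal.len C (suc a) ≤ Ideal.len D (suc a) → C ≤ᴵ D
  lowerRow-≤ᴵ⇒ C a b cs cq le row k with k ≟ suc a
  ... | yes refl = row
  ... | no ne = subst (_≤ _) (setAt-other (Ideal.len C) a b k ne) (le k)

  topmostDifference : ∀ (C C′ : Ideal) → C ≤ᴵ C′ → ∀ n → (∀ k → n < k → Ideal.len C k ≡ Ideal.len C′ k) →
    C ≈ᴵ C′ ⊎ Σ ℕ λ a → Ideal.len C (suc a) < Ideal.len C′ (suc a) × (∀ k → suc a < k → Ideal.len C k ≡ Ideal.len C′ k)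
  topmostDifference C C′ le zero h = inj₁ agree
    where
    agree : C ≈ᴵ C′
    agree zero = trans (len-base C) (sym (len-base C′))
    agree (suc k) = h (suc k) (s≤s z≤n)
  topmostDifference C C′ le (suc n) h with Ideal.len C (suc n) ≟ Ideal.len C′ (suc n)
  ... | no ne = inj₂ (n , ≤∧≢⇒< (le (suc n)) ne , h)
  ... | yes e = topmostDifference C C′ le n h′
    where
    h′ : ∀ k → n < k → Ideal.len C k ≡ Ideal.len C′ k
    h′ k lt with m≤n⇒m<n∨m≡n lt
    ... | inj₁ lt′ = h k lt′
    ... | inj₂ refl = e

  agree-beyond : ∀ (C C′ : Ideal) k → m < k → Ideal.len C k ≡ Ideal.len C′ k
  agree-beyond C C′ (suc i) (s≤s mi) = trans (len-beyond C i (λ lt → <-irrefl refl (≤-trans lt mi))) (sym (len-beyond C′ i (λ lt → <-irrefl refl (≤-trans lt mi))))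

  emptyIdeal : Ideal
  emptyIdeal = ideal (λ { zero → ρ 0 ; (suc _) → 0 }) refl (λ _ → z≤n) (λ _ → z≤n)

  emptyIdeal-≤ᴵ : ∀ C → emptyIdeal ≤ᴵ C
  emptyIdeal-≤ᴵ C zero = ≤-reflexive (sym (len-base C))
  emptyIdeal-≤ᴵ C (suc k) = z≤n

  principal : ℕ → ℕ → ℕ → ℕ
  principal t j zero = ρ 0
  principal t j (suc k) with k ≤? t
  ... | yes _ = j
  ... | no _ = 0

  principal-≤ : ∀ t j k → k ≤ t → principal t j (suc k) ≡ j
  principal-≤ t j k le with k ≤? t
  ... | yes _ = refl
  ... | no n = ⊥-elim (n le)

  principal-≰ : ∀ t j k → ¬ k ≤ t → principal t j (suc k) ≡ 0
  principal-≰ t j k n with k ≤? t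
  ... | yes y = ⊥-elim (n y)
  ... | no _ = refl

  principalIdeal : (t j : ℕ) → j ≤ ρ t → Ideal
  principalIdeal t j jρ = ideal (principal t j) refl below-ρ antitone
    where
    below-ρ : ∀ k → principal t j (suc k) ≤ ρ k
    below-ρ k with k ≤? t
    ... | yes kt = ≤-trans jρ (ρ-antitone k t kt)
    ... | no _ = z≤n
    antitone : ∀ k → principal t j (suc k) ≤ principal t j k
    antitone zero = subst (_≤ ρ 0) (sym (principal-≤ t j 0 z≤n)) (≤-trans jρ (ρ-antitone 0 t z≤n))
    antitone (suc k) with suc k ≤? t
    ... | yes kt = ≤-reflexive (sym (principal-≤ t j k (≤-trans (n≤1+n k) kt)))
    ... | no _ = z≤n

  principalIdeal-≤ᴵ : ∀ {t j jρ} C → j ≤ Ideal.len C (suc t) → principalIdeal t j jρ ≤ᴵ C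
  principalIdeal-≤ᴵ C le zero = ≤-reflexive (sym (len-base C))
  principalIdeal-≤ᴵ {t} {j} C le (suc k) with k ≤? t
  ... | yes kt = ≤-trans le (len-antitone C (suc k) (suc t) (s≤s kt))
  ... | no _ = z≤n

  principalIdeal-≤ᴵ⁻ : ∀ {t j jρ} C → principalIdeal t j jρ ≤ᴵ C → j ≤ Ideal.len C (suc t)
  principalIdeal-≤ᴵ⁻ {t} {j} C le = subst (_≤ _) (principal-≤ t j t ≤-refl) (le (suc t))

  module IdealOrder = Order _≈ᴵ_ _≤ᴵ_

  -- Below a principal ideal P = ⟨h_{t+1,j}⟩, everything other than P misses the generator,
  -- so it lies below P with row t+1 shortened by one.
  principalIdeal-joinIrreducible : ∀ t j (jρ : j ≤ ρ t) → 1 ≤ j → IdealOrder.JoinIrreducible (principalIdeal t j jρ)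
  principalIdeal-joinIrreducible t j jρ 1≤j =
    (λ least → 1≰0 (≤-trans 1≤j (principalIdeal-≤ᴵ⁻ {t} {j} {jρ} emptyIdeal (least emptyIdeal)))) ,
    λ y z (_ , _ , lub) y<P z<P →
      lowerRow-≉ P t (pred j) cs cq
        (≈ᴵ-antisym {Q} {P} (lowerRow-≤ᴵ P t (pred j) cs cq) (lub Q (strictlyBelow {y} y<P) (strictlyBelow {z} z<P)))
    where
    P = principalIdeal t j jρ
    cs : principal t j (suc t) ≡ suc (pred j)
    cs = trans (principal-≤ t j t ≤-refl) (sym (suc-pred j {{>-nonZero 1≤j}}))
    cq : principal t j (suc (suc t)) ≤ pred j
    cq = subst (_≤ pred j) (sym (principal-≰ t j (suc t) 1+n≰n)) z≤n
    Q = lowerRow P t (pred j) cs cq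
    strictlyBelow : ∀ {y} → IdealOrder._<_ y P → y ≤ᴵ Q
    strictlyBelow {y} (y≤P , y≉P) = ≤ᴵ-lowerRow {y} P t (pred j) cs cq y≤P (≮⇒≥ λ pj<y →
      y≉P (≈ᴵ-antisym {y} {P} y≤P (principalIdeal-≤ᴵ {t} {j} {jρ} y (subst (_≤ _) (suc-pred j {{>-nonZero 1≤j}}) pj<y))))

  -- If C ≠ ⟨h_{a+1,j}⟩ for its topmost nonempty row a+1 of length j, then C is the join of that
  -- principal ideal and C with row a+1 shortened.
  joinIrreducible⇒principal : ∀ C → IdealOrder.JoinIrreducible C →
    Σ ℕ λ a → Σ ℕ λ j → a < m × 1 ≤ j × Σ (j ≤ ρ a) λ jρ → principalIdeal a j jρ ≈ᴵ C
  joinIrreducible⇒principal C (notLeast , irreducible)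
    with topmostDifference emptyIdeal C (emptyIdeal-≤ᴵ C) m (agree-beyond emptyIdeal C)
  ... | inj₁ C≈∅ = ⊥-elim (notLeast λ D k → ≤-trans (≤-reflexive (sym (C≈∅ k))) (emptyIdeal-≤ᴵ D k))
  ... | inj₂ (a , 0<j , top) =
    a , j , ρ-pos⇒< a (≤-trans 0<j jρ) , 0<j , jρ , ≈ᴵ-stable {P} {C} λ P≉C →
      irreducible P Q (P≤C , Q≤C , λ u P≤u Q≤u → lowerRow-≤ᴵ⇒ {u} C a (pred j) cs cq Q≤u (principalIdeal-≤ᴵ⁻ {a} {j} {jρ} u P≤u))
        (P≤C , P≉C) (Q≤C , lowerRow-≉ C a (pred j) cs cq)
    where
    j = Ideal.len C (suc a)
    jρ = len≤ρ C a
    P = principalIdeal a j jρ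
    P≤C : P ≤ᴵ C
    P≤C = principalIdeal-≤ᴵ {a} {j} {jρ} C ≤-refl
    cs : j ≡ suc (pred j)
    cs = sym (suc-pred j {{>-nonZero 0<j}})
    cq : Ideal.len C (suc (suc a)) ≤ pred j
    cq = subst (_≤ pred j) (top (suc (suc a)) ≤-refl) z≤n
    Q = lowerRow C a (pred j) cs cq
    Q≤C : Q ≤ᴵ C
    Q≤C = lowerRow-≤ᴵ C a (pred j) cs cq

  principalIdeal-≤ᴵ-iff : ∀ {t j jρ t′ j′ jρ′} → 1 ≤ j →
    principalIdeal t j jρ ≤ᴵ principalIdeal t′ j′ jρ′ ⇔ (t ≤ t′ × j ≤ j′)
  principalIdeal-≤ᴵ-iff {t} {j} {jρ} {t′} {j′} {jρ′} 1≤j = mk⇔ forward backward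
    where
    forward : principalIdeal t j jρ ≤ᴵ principalIdeal t′ j′ jρ′ → t ≤ t′ × j ≤ j′
    forward le with t ≤? t′ | principalIdeal-≤ᴵ⁻ {t} {j} {jρ} (principalIdeal t′ j′ jρ′) le
    ... | yes tt | j≤j′ = tt , j≤j′
    ... | no _ | j≤0 = ⊥-elim (1≰0 (≤-trans 1≤j j≤0))
    backward : t ≤ t′ × j ≤ j′ → principalIdeal t j jρ ≤ᴵ principalIdeal t′ j′ jρ′
    backward (tt , jj) = principalIdeal-≤ᴵ {t} {j} {jρ} (principalIdeal t′ j′ jρ′) (subst (j ≤_) (sym (principal-≤ t′ j′ t tt)) jj)

  hexagonIdeal : FElem m r → Ideal
  hexagonIdeal (i , j , _ , j≤r) = principalIdeal (toℕ i) j (≤r⇒≤ρ i refl j≤r)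

  hexagonIdeal-joinIrreducible : ∀ h → IdealOrder.JoinIrreducible (hexagonIdeal h)
  hexagonIdeal-joinIrreducible (i , j , 1≤j , j≤r) = principalIdeal-joinIrreducible (toℕ i) j (≤r⇒≤ρ i refl j≤r) 1≤j

  joinIrreducible⇒hexagonIdeal : ∀ C → IdealOrder.JoinIrreducible C → Σ (FElem m r) λ h → hexagonIdeal h ≈ᴵ C
  joinIrreducible⇒hexagonIdeal C ji with joinIrreducible⇒principal C ji
  ... | a , j , a<m , 1≤j , jρ , P≈C =
    (fromℕ< a<m , j , 1≤j , subst (j ≤_) (ρ-fromℕ< a<m) jρ) ,
    λ k → trans (cong (λ t → principal t j k) toℕ-a) (P≈C k)
    where
    toℕ-a = FP.toℕ-fromℕ< a<m

  hexagonIdeal-≤ᴵ-iff : ∀ h h′ → hexagonIdeal h ≤ᴵ hexagonIdeal h′ ⇔ h ⪯F h′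
  hexagonIdeal-≤ᴵ-iff (i , j , 1≤j , j≤r) (i′ , j′ , _ , j′≤r) =
    principalIdeal-≤ᴵ-iff {jρ = ≤r⇒≤ρ i refl j≤r} {jρ′ = ≤r⇒≤ρ i′ refl j′≤r} 1≤j

  -- Vertices and edges of L(r)

  whiteIn : ℕ → ℕ → Bool
  whiteIn zero _ = false
  whiteIn (suc _) zero = false
  whiteIn (suc zero) (suc b) = does (suc b ≤? ρ 0)
  whiteIn (suc (suc i)) (suc b) = does (1 ≤? ρ i) ∧ does (b ≤? ρ i)

  whiteIn-first : ∀ b → suc b ≤ ρ 0 → whiteIn 1 (suc b) ≡ true
  whiteIn-first b h = dec-true (suc b ≤? ρ 0) h

  whiteIn-row : ∀ i b → 1 ≤ ρ i → b ≤ ρ i → whiteIn (suc (suc i)) (suc b) ≡ true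
  whiteIn-row i b h1 h2 = ∧-true (dec-true (1 ≤? ρ i) h1) (dec-true (b ≤? ρ i) h2)

  whiteIn-first⇒ : ∀ b → whiteIn 1 (suc b) ≡ true → suc b ≤ ρ 0
  whiteIn-first⇒ b h = does-true⇒ (suc b ≤? ρ 0) h

  whiteIn-row⇒ : ∀ i b → whiteIn (suc (suc i)) (suc b) ≡ true → 1 ≤ ρ i × b ≤ ρ i
  whiteIn-row⇒ i b h = does-true⇒ (1 ≤? ρ i) (∧-true⇒ˡ _ _ h) , does-true⇒ (b ≤? ρ i) (∧-true⇒ʳ (does (1 ≤? ρ i)) _ h)

  BlackIn : ℕ → ℕ → Set
  BlackIn zero y = 1 ≤ ρ 0 × y ≤ ρ 0
  BlackIn (suc i) y = 1 ≤ ρ i × y ≤ ρ i × (1 ≤ y ⊎ 1 ≤ ρ (suc i))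

  vertexOf-white⇒ : ∀ {A B} → VertexOf H (white A B) → Σ ℕ λ a → Σ ℕ λ b → A ≡ + suc a × B ≡ + suc b × whiteIn (suc a) (suc b) ≡ true
  vertexOf-white⇒ (_ , _ , ((f , j , 1≤j , j≤r) , refl , refl) , there (here refl)) =
    suc (toℕ f) , j , +n+1 (suc (toℕ f)) , +n+1 j ,
    whiteIn-row (toℕ f) j (≤r⇒≤ρ f refl (r-pos f)) (≤r⇒≤ρ f refl j≤r)
  vertexOf-white⇒ (_ , _ , ((f , suc j , 1≤j , j≤r) , refl , refl) , there (there (there (here refl)))) with toℕ f in eq
  ... | zero = 0 , j , refl , refl , whiteIn-first j (≤r⇒≤ρ f eq j≤r)
  ... | suc t = suc t , j , refl , refl ,
    whiteIn-row t j (≤-trans (≤r⇒≤ρ f eq (r-pos f)) (ρ-suc≤ t))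
             (≤-trans (n≤1+n j) (≤-trans (≤r⇒≤ρ f eq j≤r) (ρ-suc≤ t)))
  vertexOf-white⇒ (_ , _ , ((f , suc j , 1≤j , j≤r) , refl , refl) , there (there (there (there (there (here refl)))))) =
    suc (toℕ f) , j , +n+1 (suc (toℕ f)) , refl ,
    whiteIn-row (toℕ f) j (≤r⇒≤ρ f refl (r-pos f)) (≤-trans (n≤1+n j) (≤r⇒≤ρ f refl j≤r))
  vertexOf-white⇒ (_ , _ , (_ , refl , refl) , here ())
  vertexOf-white⇒ (_ , _ , (_ , refl , refl) , there (there (here ())))
  vertexOf-white⇒ (_ , _ , (_ , refl , refl) , there (there (there (there (here ())))))
  vertexOf-white⇒ (_ , _ , (_ , refl , refl) , there (there (there (there (there (there ()))))))

  vertexOf-black⇒ : ∀ {A B} → VertexOf H (black A B) → Σ ℕ λ x → Σ ℕ λ y → A ≡ + x × B ≡ + y × BlackIn x y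
  vertexOf-black⇒ (_ , _ , ((f , j , 1≤j , j≤r) , refl , refl) , here refl) =
    suc (toℕ f) , j , refl , refl , ≤r⇒≤ρ f refl (r-pos f) , ≤r⇒≤ρ f refl j≤r , inj₁ 1≤j
  vertexOf-black⇒ (_ , _ , ((f , j , 1≤j , j≤r) , refl , refl) , there (there (here refl))) with toℕ f in eq
  ... | zero = 0 , j , refl , refl , ≤r⇒≤ρ f eq (r-pos f) , ≤r⇒≤ρ f eq j≤r
  ... | suc t = suc t , j , refl , refl ,
    ≤-trans (≤r⇒≤ρ f eq (r-pos f)) (ρ-suc≤ t) ,
    ≤-trans (≤r⇒≤ρ f eq j≤r) (ρ-suc≤ t) , inj₁ 1≤j
  vertexOf-black⇒ (_ , _ , ((f , suc j , 1≤j , j≤r) , refl , refl) , there (there (there (there (here refl))))) with toℕ f in eq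
  ... | zero = 0 , j , refl , refl , ≤r⇒≤ρ f eq (r-pos f) , ≤-trans (n≤1+n j) (≤r⇒≤ρ f eq j≤r)
  ... | suc t = suc t , j , refl , refl ,
    ≤-trans (≤r⇒≤ρ f eq (r-pos f)) (ρ-suc≤ t) ,
    ≤-trans (n≤1+n j) (≤-trans (≤r⇒≤ρ f eq j≤r) (ρ-suc≤ t)) ,
    inj₂ (≤r⇒≤ρ f eq (r-pos f))
  vertexOf-black⇒ (_ , _ , (_ , refl , refl) , there (here ()))
  vertexOf-black⇒ (_ , _ , (_ , refl , refl) , there (there (there (here ()))))
  vertexOf-black⇒ (_ , _ , (_ , refl , refl) , there (there (there (there (there (here ()))))))
  vertexOf-black⇒ (_ , _ , (_ , refl , refl) , there (there (there (there (there (there ()))))))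

  hexagonOf : ∀ t j → t < m → 1 ≤ j → j ≤ ρ t → H (+ suc t) (+ j)
  hexagonOf t j t<m 1≤j j≤ρ = (fromℕ< t<m , j , 1≤j , subst (j ≤_) (ρ-fromℕ< t<m) j≤ρ) ,
    cong (λ z → + suc z) (sym (FP.toℕ-fromℕ< t<m)) , refl

  blackIn⇒vertexOf : ∀ x y → BlackIn x y → VertexOf H (black (+ x) (+ y))
  blackIn⇒vertexOf zero zero (h1 , h2) = + 1 , + 1 , hexagonOf 0 1 (ρ-pos⇒< 0 h1) ≤-refl h1 , there (there (there (there (here refl))))
  blackIn⇒vertexOf zero (suc y) (h1 , h2) = + 1 , + suc y , hexagonOf 0 (suc y) (ρ-pos⇒< 0 h1) (s≤s z≤n) h2 , there (there (here refl))
  blackIn⇒vertexOf (suc i) (suc y) (h1 , h2 , _) = + suc i , + suc y , hexagonOf i (suc y) (ρ-pos⇒< i h1) (s≤s z≤n) h2 , here refl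
  blackIn⇒vertexOf (suc i) zero (h1 , h2 , inj₂ h3) = + suc (suc i) , + 1 , hexagonOf (suc i) 1 (ρ-pos⇒< (suc i) h3) ≤-refl h3 , there (there (there (there (here refl))))

  whiteIn⇒vertexOf : ∀ a b → whiteIn (suc a) (suc b) ≡ true → VertexOf H (white (+ suc a) (+ suc b))
  whiteIn⇒vertexOf zero b h =
    + 1 , + suc b , hexagonOf 0 (suc b) (ρ-pos⇒< 0 (≤-trans (s≤s z≤n) (whiteIn-first⇒ b h))) (s≤s z≤n) (whiteIn-first⇒ b h) , there (there (there (here refl)))
  whiteIn⇒vertexOf (suc i) (suc b) h =
    + suc i , + suc b , hexagonOf i (suc b) (ρ-pos⇒< i (proj₁ (whiteIn-row⇒ i (suc b) h))) (s≤s z≤n) (proj₂ (whiteIn-row⇒ i (suc b) h)) , mem2 i (suc b)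
    where
    mem2 : ∀ t j → white (+ suc (suc t)) (+ suc j) ∈ hexVertices (+ suc t) (+ j)
    mem2 t j rewrite +-comm t 1 | +-comm j 1 = there (here refl)
  whiteIn⇒vertexOf (suc i) zero h = + suc i , + 1 , hexagonOf i 1 (ρ-pos⇒< i (proj₁ (whiteIn-row⇒ i 0 h))) ≤-refl (proj₁ (whiteIn-row⇒ i 0 h)) , mem6 i
    where
    mem6 : ∀ t → white (+ suc (suc t)) (+ 1) ∈ hexVertices (+ suc t) (+ 1)
    mem6 t rewrite +-comm t 1 = there (there (there (there (there (here refl)))))

  whiteIn-upperRight : ∀ f j → j ≤ r f → whiteIn (suc (suc (toℕ f))) (suc j) ≡ true
  whiteIn-upperRight f j j≤r = whiteIn-row (toℕ f) j (≤r⇒≤ρ f refl (r-pos f)) (≤r⇒≤ρ f refl j≤r)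

  whiteIn-upperLeft : ∀ f j → suc j ≤ r f → whiteIn (suc (suc (toℕ f))) (suc j) ≡ true
  whiteIn-upperLeft f j j≤r = whiteIn-upperRight f j (≤-trans (n≤1+n j) j≤r)

  whiteIn-bottom : ∀ f j → suc j ≤ r f → whiteIn (suc (toℕ f)) (suc j) ≡ true
  whiteIn-bottom f j j≤r with toℕ f in eq
  ... | zero = whiteIn-first j (≤r⇒≤ρ f eq j≤r)
  ... | suc t = whiteIn-row t j (≤-trans (≤r⇒≤ρ f eq (r-pos f)) (ρ-suc≤ t))
             (≤-trans (n≤1+n j) (≤-trans (≤r⇒≤ρ f eq j≤r) (ρ-suc≤ t)))

  EdgeShape : Edge → Set
  EdgeShape (edge A B d) = Σ ℕ λ a → Σ ℕ λ b → A ≡ + suc a × B ≡ + suc b × whiteIn (suc a) (suc b) ≡ true ×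
    (a ≡ 0 → d ≢ d3) × (a ≡ m → b ≡ 0 → d ≢ d2) × (d ≡ d1 → suc b ≤ ρ (Data.Nat.pred a))

  edgeOf⇒shape : ∀ e → EdgeOf H e → EdgeShape e
  edgeOf⇒shape _ (_ , _ , ((f , j , 1≤j , j≤r) , refl , refl) , here refl) =
    suc (toℕ f) , j , +n+1 (suc (toℕ f)) , +n+1 j , whiteIn-upperRight f j j≤r ,
    (λ ()) , (λ _ j≡0 _ → 1≰0 (subst (1 ≤_) j≡0 1≤j)) , λ ()
  edgeOf⇒shape _ (_ , _ , ((f , j , 1≤j , j≤r) , refl , refl) , there (here refl)) =
    suc (toℕ f) , j , +n+1 (suc (toℕ f)) , +n+1 j , whiteIn-upperRight f j j≤r ,
    (λ e _ → 1+n≢0 e) , (λ _ _ ()) , λ ()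
  edgeOf⇒shape _ (_ , _ , ((f , suc j , 1≤j , j≤r) , refl , refl) , there (there (here refl))) =
    toℕ f , j , refl , refl , whiteIn-bottom f j j≤r , (λ _ ()) , (λ _ _ ()) , λ _ → ≤-trans (≤r⇒≤ρ f refl j≤r) (ρ-antitone _ _ (pred[n]≤n {toℕ f}))
  edgeOf⇒shape _ (_ , _ , ((f , suc j , 1≤j , j≤r) , refl , refl) , there (there (there (here refl)))) =
    toℕ f , j , refl , refl , whiteIn-bottom f j j≤r , (λ _ ()) , (λ e _ _ → <-irrefl e (FP.toℕ<n f)) , λ ()
  edgeOf⇒shape _ (_ , _ , ((f , suc j , 1≤j , j≤r) , refl , refl) , there (there (there (there (here refl))))) =
    suc (toℕ f) , j , +n+1 (suc (toℕ f)) , refl , whiteIn-upperLeft f j j≤r , (λ e _ → 1+n≢0 e) , (λ _ _ ()) , λ ()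
  edgeOf⇒shape _ (_ , _ , ((f , suc j , 1≤j , j≤r) , refl , refl) , there (there (there (there (there (here refl)))))) =
    suc (toℕ f) , j , +n+1 (suc (toℕ f)) , refl , whiteIn-upperLeft f j j≤r , (λ _ ()) , (λ _ _ ()) , λ _ → ≤r⇒≤ρ f refl j≤r
  edgeOf⇒shape _ (_ , _ , (_ , refl , refl) , there (there (there (there (there (there ()))))))

  data BlackNeighbour (x y : ℕ) : Edge → Set where
    nb1 : BlackNeighbour x y (edge (+ suc x) (+ y) d1)
    nb2 : BlackNeighbour x y (edge (+ suc x) (+ suc y) d2)
    nb3 : BlackNeighbour x y (edge (+ suc (suc x)) (+ suc y) d3)

  blackNeighbour : ∀ x y e → Incident (black (+ x) (+ y)) e → BlackNeighbour x y e
  blackNeighbour x y (edge (+ suc a) B d1) refl = nb1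
  blackNeighbour x y (edge (+ zero) B d1) ()
  blackNeighbour x y (edge -[1+ n ] B d1) ()
  blackNeighbour x y (edge (+ suc a) (+ suc b) d2) refl = nb2
  blackNeighbour x y (edge (+ suc a) (+ zero) d2) ()
  blackNeighbour x y (edge (+ suc a) -[1+ n ] d2) ()
  blackNeighbour x y (edge (+ zero) B d2) ()
  blackNeighbour x y (edge -[1+ n ] B d2) ()
  blackNeighbour x y (edge (+ suc (suc a)) (+ suc b) d3) refl = nb3
  blackNeighbour x y (edge (+ suc (suc a)) (+ zero) d3) ()
  blackNeighbour x y (edge (+ suc (suc a)) -[1+ n ] d3) ()
  blackNeighbour x y (edge (+ suc zero) B d3) ()
  blackNeighbour x y (edge (+ zero) B d3) ()
  blackNeighbour x y (edge -[1+ n ] B d3) ()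

  -- The perfect matching of an ideal

  matchingOf : (ℕ → ℕ) → Edge → Bool
  matchingOf c (edge (+ suc a) (+ suc b) d) = whiteIn (suc a) (suc b) ∧ sameDir (matchDir (c a) (c (suc a)) (suc b)) d
  matchingOf c (edge (+ suc a) (+ zero) d) = false
  matchingOf c (edge (+ suc a) -[1+ _ ] d) = false
  matchingOf c (edge (+ zero) _ d) = false
  matchingOf c (edge -[1+ _ ] _ d) = false

  matchingOf⇒ : ∀ c e → matchingOf c e ≡ true → Σ ℕ λ a → Σ ℕ λ b →
    e ≡ edge (+ suc a) (+ suc b) (matchDir (c a) (c (suc a)) (suc b)) × whiteIn (suc a) (suc b) ≡ true
  matchingOf⇒ c (edge (+ suc a) (+ suc b) d) h =
    a , b , cong (edge _ _) (sym (sameDir⇒≡ _ _ (∧-true⇒ʳ (whiteIn (suc a) (suc b)) _ h))) , ∧-true⇒ˡ _ _ h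

  matchingOf-dir : ∀ c a b d → matchingOf c (edge (+ suc a) (+ suc b) d) ≡ true → matchDir (c a) (c (suc a)) (suc b) ≡ d
  matchingOf-dir c a b d h = sameDir⇒≡ _ _ (∧-true⇒ʳ (whiteIn (suc a) (suc b)) _ h)

  matchingOf-intro : ∀ c a b d → whiteIn (suc a) (suc b) ≡ true → matchDir (c a) (c (suc a)) (suc b) ≡ d → matchingOf c (edge (+ suc a) (+ suc b) d) ≡ true
  matchingOf-intro c a b d h refl = ∧-true h (sameDir-refl _)

  matchingOf-intro′ : ∀ c x y d p q → c x ≡ p → c (suc x) ≡ q → whiteIn (suc x) (suc y) ≡ true → matchDir p q (suc y) ≡ d →
    matchingOf c (edge (+ suc x) (+ suc y) d) ≡ true
  matchingOf-intro′ c x y d p q refl refl iw e = matchingOf-intro c x y d iw e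

  matchingOf-false : ∀ c x y d p q → c x ≡ p → c (suc x) ≡ q → (matchDir p q (suc y) ≡ d → ⊥) → matchingOf c (edge (+ suc x) (+ suc y) d) ≡ false
  matchingOf-false c x y d p q refl refl n = ≢true⇒≡false (λ h → n (matchingOf-dir c x y d h))

  matchingOf-local : ∀ c c′ x y d → c x ≡ c′ x → c (suc x) ≡ c′ (suc x) →
    matchingOf c (edge (+ suc x) (+ suc y) d) ≡ matchingOf c′ (edge (+ suc x) (+ suc y) d)
  matchingOf-local c c′ x y d e1 e2 rewrite e1 | e2 = refl

  ∈hex-upperRight : ∀ t j → edge (+ suc (suc t)) (+ suc j) d2 ∈ hexEdges (+ suc t) (+ j)
  ∈hex-upperRight t j rewrite +-comm t 1 | +-comm j 1 = here refl
  ∈hex-right : ∀ t j → edge (+ suc (suc t)) (+ suc j) d3 ∈ hexEdges (+ suc t) (+ j)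
  ∈hex-right t j rewrite +-comm t 1 | +-comm j 1 = there (here refl)
  ∈hex-lowerRight : ∀ t j → edge (+ suc t) (+ j) d1 ∈ hexEdges (+ suc t) (+ j)
  ∈hex-lowerRight t j = there (there (here refl))
  ∈hex-lowerLeft : ∀ t j → edge (+ suc t) (+ j) d2 ∈ hexEdges (+ suc t) (+ j)
  ∈hex-lowerLeft t j = there (there (there (here refl)))
  ∈hex-left : ∀ t j → edge (+ suc (suc t)) (+ j) d3 ∈ hexEdges (+ suc t) (+ j)
  ∈hex-left t j rewrite +-comm t 1 = there (there (there (there (here refl))))
  ∈hex-upperLeft : ∀ t j → edge (+ suc (suc t)) (+ j) d1 ∈ hexEdges (+ suc t) (+ j)
  ∈hex-upperLeft t j rewrite +-comm t 1 = there (there (there (there (there (here refl)))))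

  edgeOf-hex : ∀ {e} t j → t < m → 1 ≤ j → j ≤ ρ t → e ∈ hexEdges (+ suc t) (+ j) → EdgeOf H e
  edgeOf-hex t j a b c mem = + suc t , + j , hexagonOf t j a b c , mem

  module _ (C : Ideal) where
    private
      c = Ideal.len C

    matchingOf-edgeOf : ∀ e → matchingOf c e ≡ true → EdgeOf H e
    matchingOf-edgeOf e h with matchingOf⇒ c e h
    ... | a , b , refl , iw with matchDir (c a) (c (suc a)) (suc b) in eq
    matchingOf-edgeOf e h | zero , b , refl , iw | d1 =
      edgeOf-hex 0 (suc b) (ρ-pos⇒< 0 (≤-trans (s≤s z≤n) (whiteIn-first⇒ b iw))) (s≤s z≤n) (whiteIn-first⇒ b iw) (∈hex-lowerRight 0 (suc b))
    matchingOf-edgeOf e h | suc t , b , refl , iw | d1 =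
      edgeOf-hex t (suc b) (ρ-pos⇒< t (proj₁ (whiteIn-row⇒ t b iw))) (s≤s z≤n)
        (≤-trans (proj₂ (matchDir≡d1⇒ (c (suc t)) (c (suc (suc t))) (suc b) eq)) (len≤ρ C t)) (∈hex-upperLeft t (suc b))
    matchingOf-edgeOf e h | zero , b , refl , iw | d2 =
      edgeOf-hex 0 (suc b) (ρ-pos⇒< 0 (≤-trans (s≤s z≤n) (whiteIn-first⇒ b iw))) (s≤s z≤n) (whiteIn-first⇒ b iw) (∈hex-lowerLeft 0 (suc b))
    matchingOf-edgeOf e h | suc t , suc b , refl , iw | d2 =
      edgeOf-hex t (suc b) (ρ-pos⇒< t (proj₁ (whiteIn-row⇒ t (suc b) iw))) (s≤s z≤n) (proj₂ (whiteIn-row⇒ t (suc b) iw)) (∈hex-upperRight t (suc b))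
    matchingOf-edgeOf e h | suc t , zero , refl , iw | d2 = edgeOf-hex (suc t) 1 (ρ-pos⇒< (suc t) h1) ≤-refl h1 (∈hex-lowerLeft (suc t) 1)
      where
      nonzero : ∀ {p q} → (1 ≢ suc p) × (q < 1 → 1 ≤ p → ⊥) → 1 ≤ q
      nonzero {zero} (1≢1 , _) = ⊥-elim (1≢1 refl)
      nonzero {suc _} {zero} (_ , ¬d1) = ⊥-elim (¬d1 (s≤s z≤n) (s≤s z≤n))
      nonzero {suc _} {suc _} _ = s≤s z≤n
      h1 : 1 ≤ ρ (suc t)
      h1 = ≤-trans (nonzero (matchDir≡d2⇒ (c (suc t)) (c (suc (suc t))) 1 eq)) (len≤ρ C (suc t))
    matchingOf-edgeOf e h | zero , b , refl , iw | d3 =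
      ⊥-elim (1+n≰n (subst (λ z → suc z ≤ ρ 0) (trans (suc-injective (matchDir≡d3⇒ (c 0) (c 1) (suc b) eq)) (len-base C)) (whiteIn-first⇒ b iw)))
    matchingOf-edgeOf e h | suc t , suc b , refl , iw | d3 =
      edgeOf-hex t (suc b) (ρ-pos⇒< t (proj₁ (whiteIn-row⇒ t (suc b) iw))) (s≤s z≤n) (proj₂ (whiteIn-row⇒ t (suc b) iw)) (∈hex-right t (suc b))
    matchingOf-edgeOf e h | suc t , zero , refl , iw | d3 =
      edgeOf-hex t 1 (ρ-pos⇒< t (proj₁ (whiteIn-row⇒ t 0 iw))) ≤-refl (proj₁ (whiteIn-row⇒ t 0 iw)) (∈hex-left t 1)

    Covered : Vtx → Set
    Covered v = Σ Edge λ e → matchingOf c e ≡ true × Incident v e × (∀ e′ → matchingOf c e′ ≡ true → Incident v e′ → e′ ≡ e)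

    white-covered : ∀ a b → whiteIn (suc a) (suc b) ≡ true → Covered (white (+ suc a) (+ suc b))
    white-covered a b iw = edge (+ suc a) (+ suc b) (matchDir (c a) (c (suc a)) (suc b)) , matchingOf-intro c a b _ iw refl , refl ,
      λ { (edge _ _ d) h refl → cong (edge _ _) (sym (matchingOf-dir c a b d h)) }

    d1-matched⇒ : ∀ x y → matchingOf c (edge (+ suc x) (+ y) d1) ≡ true → c (suc x) < y × y ≤ c x
    d1-matched⇒ x (suc y) h = matchDir≡d1⇒ (c x) (c (suc x)) (suc y) (matchingOf-dir c x y d1 h)
    d2-matched⇒ : ∀ x y → matchingOf c (edge (+ suc x) (+ suc y) d2) ≡ true →
      (suc y ≡ suc (c x) → ⊥) × (c (suc x) < suc y → suc y ≤ c x → ⊥)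
    d2-matched⇒ x y h = matchDir≡d2⇒ (c x) (c (suc x)) (suc y) (matchingOf-dir c x y d2 h)
    d3-matched⇒ : ∀ x y → matchingOf c (edge (+ suc (suc x)) (+ suc y) d3) ≡ true → y ≡ c (suc x)
    d3-matched⇒ x y h = suc-injective (matchDir≡d3⇒ (c (suc x)) (c (suc (suc x))) (suc y) (matchingOf-dir c (suc x) y d3 h))

    1≤ρ-belowVertical : ∀ x y → BlackIn x y → y ≡ c (suc x) → 1 ≤ ρ x
    1≤ρ-belowVertical zero y (h1 , _) _ = h1
    1≤ρ-belowVertical (suc i) y (_ , _ , inj₂ h) _ = h
    1≤ρ-belowVertical (suc i) y (_ , _ , inj₁ h) e = ≤-trans h (subst (_≤ ρ (suc i)) (sym e) (len≤ρ C (suc i)))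

    whiteIn-d2-neighbour : ∀ x y → BlackIn x y → (x ≡ 0 → suc y ≤ ρ 0) → whiteIn (suc x) (suc y) ≡ true
    whiteIn-d2-neighbour zero y (h1 , h2) f = whiteIn-first y (f refl)
    whiteIn-d2-neighbour (suc i) y (h1 , h2 , _) f = whiteIn-row i y h1 h2

    whiteIn-d1-neighbour : ∀ x y → BlackIn x (suc y) → whiteIn (suc x) (suc y) ≡ true
    whiteIn-d1-neighbour zero y (h1 , h2) = whiteIn-first y h2
    whiteIn-d1-neighbour (suc i) y (h1 , h2 , _) = whiteIn-row i y h1 (≤-trans (n≤1+n y) h2)

    black-covered : ∀ x y → BlackIn x y → Covered (black (+ x) (+ y))
    black-covered x y ib with <-cmp y (c (suc x))
    ... | tri≈ _ y≡q _ = edge (+ suc (suc x)) (+ suc y) d3 ,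
          matchingOf-intro c (suc x) y d3 (whiteIn-row x y (1≤ρ-belowVertical x y ib y≡q) (subst (_≤ ρ x) (sym y≡q) (len≤ρ C x)))
            (matchDir-d3 _ _ _ (cong suc y≡q)) ,
          refl , uq
      where
      uq : ∀ e′ → matchingOf c e′ ≡ true → Incident (black (+ x) (+ y)) e′ → e′ ≡ _
      uq e′ h inc with blackNeighbour x y e′ inc
      ... | nb1 = ⊥-elim (<-irrefl (sym y≡q) (proj₁ (d1-matched⇒ x y h)))
      ... | nb2 =
        ⊥-elim (proj₁ i2 (cong suc (≤-antisym (subst (_≤ c x) (sym y≡q) (len-suc≤ C x)) (≮⇒≥ λ lt → proj₂ i2 (s≤s (≤-reflexive (sym y≡q))) lt))))
        where i2 = d2-matched⇒ x y h
      ... | nb3 = refl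
    ... | tri< y<q _ _ = edge (+ suc x) (+ suc y) d2 ,
          matchingOf-intro c x y d2 iw (matchDir-d2-low _ _ _ y<q (len-suc≤ C x)) , refl , uq
      where
      iw : whiteIn (suc x) (suc y) ≡ true
      iw = whiteIn-d2-neighbour x y ib (λ { refl → ≤-trans y<q (subst (c 1 ≤_) (len-base C) (len-suc≤ C 0)) })
      uq : ∀ e′ → matchingOf c e′ ≡ true → Incident (black (+ x) (+ y)) e′ → e′ ≡ _
      uq e′ h inc with blackNeighbour x y e′ inc
      ... | nb1 = ⊥-elim (<-asym y<q (proj₁ (d1-matched⇒ x y h)))
      ... | nb2 = refl
      ... | nb3 = ⊥-elim (<-irrefl (d3-matched⇒ x y h) y<q)
    ... | tri> _ _ q<y with y ≤? c x
    ...   | yes y≤p = d1-covered x y ib q<y y≤p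
      where
      d1-covered : ∀ x y → BlackIn x y → c (suc x) < y → y ≤ c x → Covered (black (+ x) (+ y))
      d1-covered x (suc y') ib q<y y≤p = edge (+ suc x) (+ suc y') d1 , matchingOf-intro c x y' d1 iw (matchDir-d1 _ _ _ q<y y≤p) , refl , uq
        where
        iw : whiteIn (suc x) (suc y') ≡ true
        iw = whiteIn-d1-neighbour x y' ib
        uq : ∀ e′ → matchingOf c e′ ≡ true → Incident (black (+ x) (+ suc y')) e′ → e′ ≡ _
        uq e′ h inc with blackNeighbour x (suc y') e′ inc
        ... | nb1 = refl
        ... | nb2 = ⊥-elim (proj₁ i2 (cong suc (≤-antisym y≤p (≮⇒≥ λ lt → proj₂ i2 (≤-trans q<y (n≤1+n _)) lt))))
          where i2 = d2-matched⇒ x (suc y') h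
        ... | nb3 = ⊥-elim (<-irrefl (sym (d3-matched⇒ x (suc y') h)) q<y)
    ...   | no y≰p = edge (+ suc x) (+ suc y) d2 , matchingOf-intro c x y d2 iw (matchDir-d2-high _ _ _ (s≤s p<y)) , refl , uq
      where
      p<y : c x < y
      p<y = ≰⇒> y≰p
      iw : whiteIn (suc x) (suc y) ≡ true
      iw = whiteIn-d2-neighbour x y ib (λ { refl → ⊥-elim (<⇒≱ p<y (subst (y ≤_) (sym (len-base C)) (proj₂ ib))) })
      uq : ∀ e′ → matchingOf c e′ ≡ true → Incident (black (+ x) (+ y)) e′ → e′ ≡ _
      uq e′ h inc with blackNeighbour x y e′ inc
      ... | nb1 = ⊥-elim (y≰p (proj₂ (d1-matched⇒ x y h)))
      ... | nb2 = refl
      ... | nb3 = ⊥-elim (y≰p (subst (_≤ c x) (sym (d3-matched⇒ x y h)) (len-suc≤ C x)))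

    matchingOf-perfect : IsPerfectMatching H (matchingOf c)
    matchingOf-perfect = matchingOf-edgeOf , vv
      where
      vv : ∀ v → VertexOf H v → Covered v
      vv (white A B) vo with vertexOf-white⇒ vo
      ... | a , b , refl , refl , iw = white-covered a b iw
      vv (black A B) vo with vertexOf-black⇒ vo
      ... | x , y , refl , refl , ib = black-covered x y ib

  toMatching : Ideal → PM H
  toMatching C = pm (matchingOf (Ideal.len C)) (matchingOf-perfect C)

  -- Decoding a perfect matching

  -- Strip k consists of the whites white (k+1, b) and the blacks black (k, j); it lies between
  -- row k (length given by the entering vertical edge) and row k+1. Strip 0 has blacks 0 … ρ 0.
  blackCount : ℕ → ℕ
  blackCount zero = ρ 0
  blackCount (suc i) = ρ i

  whiteCount : ℕ → ℕ
  whiteCount zero = ρ 0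
  whiteCount (suc i) = suc (ρ i)

  ρ≤blackCount : ∀ k → ρ k ≤ blackCount k
  ρ≤blackCount zero = ≤-refl
  ρ≤blackCount (suc i) = ρ-suc≤ i

  module Decode (M : PM H) where
    matched : Edge → Bool
    matched = mat M

    shape : ∀ e → matched e ≡ true → EdgeShape e
    shape e h = edgeOf⇒shape e (proj₁ (isPM M) e h)

    unmatched : ∀ e → ¬ EdgeShape e → matched e ≡ false
    unmatched e n = ≢true⇒≡false (λ h → n (shape e h))

    covers : ∀ v → VertexOf H v → Σ Edge λ e → matched e ≡ true × Incident v e × (∀ e′ → matched e′ ≡ true → Incident v e′ → e′ ≡ e)
    covers = proj₂ (isPM M)

    stripEdge : ℕ → ℕ → Dir → Bool
    stripEdge k b d = matched (edge (+ suc k) (+ b) d)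

    -- Above the top strip the row has length 0, as if a vertical edge sat at column 0.
    verticalAbove : ℕ → ℕ → Bool
    verticalAbove k j with k <? m
    ... | yes _ = matched (edge (+ suc (suc k)) (+ suc j) d3)
    ... | no _ = j ≡ᵇ 0

    verticalAbove-< : ∀ k j → k < m → verticalAbove k j ≡ matched (edge (+ suc (suc k)) (+ suc j) d3)
    verticalAbove-< k j k<m with k <? m
    ... | yes _ = refl
    ... | no n = ⊥-elim (n k<m)

    verticalAbove-≮ : ∀ k j → ¬ k < m → verticalAbove k j ≡ (j ≡ᵇ 0)
    verticalAbove-≮ k j n with k <? m
    ... | yes y = ⊥-elim (n y)
    ... | no _ = refl

    white-matched : ∀ k → k ≤ m → ∀ b → 1 ≤ b → b ≤ whiteCount k →
      Σ Dir λ d → stripEdge k b d ≡ true × (∀ d′ → stripEdge k b d′ ≡ true → d′ ≡ d)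
    white-matched k k≤m (suc b′) _ b≤ with covers (white (+ suc k) (+ suc b′)) (whiteIn⇒vertexOf k b′ (inStrip k k≤m b≤))
      where
      inStrip : ∀ k → k ≤ m → suc b′ ≤ whiteCount k → whiteIn (suc k) (suc b′) ≡ true
      inStrip zero _ h = whiteIn-first b′ h
      inStrip (suc i) k≤m (s≤s h) = whiteIn-row i b′ (ρ-pos i k≤m) h
    ... | edge _ _ d , me , refl , unique = d , me , λ d′ h → cong Edge.dir (unique (edge _ _ d′) h refl)

    black-matched′ : ∀ x y → BlackIn x y → ∀ u → matched (edge (+ suc (suc x)) (+ suc y) d3) ≡ u →
      ExactlyOne (stripEdge x y d1) (stripEdge x (suc y) d2) u
    black-matched′ x y ib u eu with covers (black (+ x) (+ y)) (blackIn⇒vertexOf x y ib)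
    ... | e , me , inc , unique with blackNeighbour x y e inc
    ... | nb1 = first me (≢true⇒≡false λ h → d2≢d1 (cong Edge.dir (unique _ h refl)))
                         (trans (sym eu) (≢true⇒≡false λ h → d3≢d1 (cong Edge.dir (unique _ h refl))))
    ... | nb2 = second (≢true⇒≡false λ h → d1≢d2 (cong Edge.dir (unique _ h refl))) me
                         (trans (sym eu) (≢true⇒≡false λ h → d3≢d2 (cong Edge.dir (unique _ h refl))))
    ... | nb3 = third (≢true⇒≡false λ h → d1≢d3 (cong Edge.dir (unique _ h refl)))
                      (≢true⇒≡false λ h → d2≢d3 (cong Edge.dir (unique _ h refl))) (trans (sym eu) me)

    no-d1-at-0 : ∀ k → stripEdge k 0 d1 ≡ false
    no-d1-at-0 k = unmatched _ (λ { (_ , _ , _ , () , _) })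

    unmatched-top-d2 : matched (edge (+ suc m) (+ 1) d2) ≡ false
    unmatched-top-d2 = unmatched _ (λ { (a , zero , refl , refl , _ , _ , ex , _) → ex refl refl refl })

    unmatched-top-d3 : ∀ y → matched (edge (+ suc (suc m)) (+ suc y) d3) ≡ false
    unmatched-top-d3 y = unmatched _ (λ { (a , b , refl , refl , iw , _) → 1≰0 (subst (1 ≤_) (ρ-≥ m ≤-refl) (proj₁ (whiteIn-row⇒ m y iw))) })

    black-matched : ∀ k → k ≤ m → ∀ j → j ≤ blackCount k →
      ExactlyOne (stripEdge k j d1) (stripEdge k (suc j) d2) (verticalAbove k j)
    black-matched k k≤m j j≤ with k <? m
    ... | yes k<m = black-matched′ k j (blackIn k k<m j≤) _ refl
      where
      blackIn : ∀ k → k < m → j ≤ blackCount k → BlackIn k j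
      blackIn zero k<m j≤ = ρ-pos 0 k<m , j≤
      blackIn (suc i) k<m j≤ = ρ-pos i (<-trans (n<1+n i) k<m) , j≤ , inj₂ (ρ-pos (suc i) k<m)
    ... | no k≮m with ≤-antisym k≤m (≮⇒≥ k≮m)
    black-matched _ _ zero _ | no _ | refl = third (no-d1-at-0 m) unmatched-top-d2 refl
    black-matched zero _ (suc j′) j≤ | no k≮m | refl = ⊥-elim (k≮m (ρ-pos⇒< 0 (≤-trans (s≤s z≤n) j≤)))
    black-matched (suc i) _ (suc j′) j≤ | no _ | refl =
      black-matched′ (suc i) (suc j′) (ρ-pos i ≤-refl , j≤ , inj₁ (s≤s z≤n)) false (unmatched-top-d3 (suc j′))

    -- The length p of row k, i.e. the column at which the vertical edge enters strip k.
    EntersAt : ℕ → ℕ → Set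
    EntersAt zero p = p ≡ ρ 0
    EntersAt (suc k) p = k < m →
      (∀ j → j ≤ blackCount k → verticalAbove k j ≡ true → j ≡ p) × verticalAbove k p ≡ true × p ≤ ρ k

    entry≤blackCount : ∀ k → k ≤ m → ∀ p → EntersAt k p → p ≤ blackCount k
    entry≤blackCount zero _ p refl = ≤-refl
    entry≤blackCount (suc k) k<m p entry = proj₂ (proj₂ (entry k<m))

    vertical-below⇒ : ∀ k → k ≤ m → ∀ p → EntersAt k p → ∀ b → 1 ≤ b → b ≤ whiteCount k → stripEdge k b d3 ≡ true → b ≡ suc p
    vertical-below⇒ zero _ p _ b _ _ g with shape _ g
    ... | (_ , _ , refl , _ , _ , ex0 , _) = ⊥-elim (ex0 refl refl)
    vertical-below⇒ (suc k) k<m p entry (suc b′) _ (s≤s b≤) g =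
      cong suc (proj₁ (entry k<m) b′ (≤-trans b≤ (ρ≤blackCount k)) (trans (verticalAbove-< k b′ k<m) g))

    vertical-below : ∀ k → k ≤ m → ∀ p → EntersAt k p → suc p ≤ whiteCount k → stripEdge k (suc p) d3 ≡ true
    vertical-below zero _ p refl h = ⊥-elim (1+n≰n h)
    vertical-below (suc k) k<m p entry h = trans (sym (verticalAbove-< k p k<m)) (proj₁ (proj₂ (entry k<m)))

    right-end : ∀ k p → EntersAt k p →
      (whiteCount k ≡ suc (blackCount k) × stripEdge k (whiteCount k) d1 ≡ false) ⊎
      (whiteCount k ≡ blackCount k × p ≡ blackCount k × stripEdge k (suc (blackCount k)) d2 ≡ false)
    right-end zero p entry = inj₂ (refl , entry , unmatched _ λ { (_ , _ , refl , refl , iw , _) → 1+n≰n (whiteIn-first⇒ (ρ 0) iw) })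
    right-end (suc i) p _ = inj₁ (refl , unmatched _ λ { (_ , _ , refl , refl , _ , _ , _ , ex1) → 1+n≰n (ex1 refl) })

    module Strip (k : ℕ) (k≤m : k ≤ m) (p : ℕ) (entry : EntersAt k p) =
      RowScan (stripEdge k) (verticalAbove k) (whiteCount k) (blackCount k) p (white-matched k k≤m) (black-matched k k≤m)
        (no-d1-at-0 k) (vertical-below⇒ k k≤m p entry) (vertical-below k k≤m p entry) (entry≤blackCount k k≤m p entry) (right-end k p entry)

    vertical≤ρ : ∀ k q → k < m → verticalAbove k q ≡ true → q ≤ ρ k
    vertical≤ρ k q k<m u with shape _ (trans (sym (verticalAbove-< k q k<m)) u)
    ... | (_ , _ , refl , refl , iw , _) = proj₂ (whiteIn-row⇒ k q iw)

    entry : ∀ k → Σ ℕ (EntersAt k)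
    entry zero = ρ 0 , refl
    entry (suc k) = next (k <? m)
      where
      next : Dec (k < m) → Σ ℕ (EntersAt (suc k))
      next (yes k<m) = S.q , λ _ → S.vertical-unique , S.vertical-q , vertical≤ρ k S.q k<m S.vertical-q
        where module S = Strip k (<⇒≤ k<m) (proj₁ (entry k)) (proj₂ (entry k))
      next (no k≮m) = 0 , λ k<m → ⊥-elim (k≮m k<m)

    len : ℕ → ℕ
    len k = proj₁ (entry k)

    len-top : ∀ i → ¬ i < m → len (suc i) ≡ 0
    len-top i n with i <? m
    ... | yes y = ⊥-elim (n y)
    ... | no _ = refl

    exit≡len : ∀ i (i≤m : i ≤ m) → Strip.q i i≤m (len i) (proj₂ (entry i)) ≡ len (suc i)
    exit≡len i i≤m = exit (i <? m)
      where
      module S = Strip i i≤m (len i) (proj₂ (entry i))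
      exit : Dec (i < m) → S.q ≡ len (suc i)
      exit (yes i<m) = proj₁ (proj₂ (entry (suc i)) i<m) S.q (≤-trans S.q≤p (entry≤blackCount i i≤m (len i) (proj₂ (entry i)))) S.vertical-q
      exit (no i≮m) = trans (sym (S.vertical-unique 0 z≤n (verticalAbove-≮ i 0 i≮m))) (sym (len-top i i≮m))

    decoded : Ideal
    decoded = ideal len refl (λ i → len≤ρ′ i (i <? m)) (λ i → len-suc≤′ i (i <? m))
      where
      len≤ρ′ : ∀ i → Dec (i < m) → len (suc i) ≤ ρ i
      len≤ρ′ i (yes i<m) = proj₂ (proj₂ (proj₂ (entry (suc i)) i<m))
      len≤ρ′ i (no i≮m) = subst (_≤ ρ i) (sym (len-top i i≮m)) z≤n
      len-suc≤′ : ∀ i → Dec (i < m) → len (suc i) ≤ len i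
      len-suc≤′ i (yes i<m) = subst (_≤ len i) (exit≡len i (<⇒≤ i<m)) (Strip.q≤p i (<⇒≤ i<m) (len i) (proj₂ (entry i)))
      len-suc≤′ i (no i≮m) = subst (_≤ len i) (sym (len-top i i≮m)) z≤n

    whiteIn⇒strip : ∀ a b → whiteIn (suc a) (suc b) ≡ true → a ≤ m × suc b ≤ whiteCount a
    whiteIn⇒strip zero b iw = z≤n , whiteIn-first⇒ b iw
    whiteIn⇒strip (suc i) b iw = ρ-pos⇒< i (proj₁ (whiteIn-row⇒ i b iw)) , s≤s (proj₂ (whiteIn-row⇒ i b iw))

    matched-matchDir : ∀ a b → whiteIn (suc a) (suc b) ≡ true → matched (edge (+ suc a) (+ suc b) (matchDir (len a) (len (suc a)) (suc b))) ≡ true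
    matched-matchDir a b iw =
      subst (λ z → matched (edge (+ suc a) (+ suc b) (matchDir (len a) z (suc b))) ≡ true) (exit≡len a a≤m)
        (S.matched-matchDir (suc b) (s≤s z≤n) (proj₂ (whiteIn⇒strip a b iw)))
      where
      a≤m = proj₁ (whiteIn⇒strip a b iw)
      module S = Strip a a≤m (len a) (proj₂ (entry a))

    decode-sound : ∀ e → matched e ≡ matchingOf len e
    decode-sound e with matched e in eq
    ... | true with shape e eq
    ...   | a , b , refl , refl , iw , _ =
      sym (matchingOf-intro len a b _ iw (trans (proj₂ (proj₂ w) _ (matched-matchDir a b iw)) (sym (proj₂ (proj₂ w) _ eq))))
      where w = white-matched a (proj₁ (whiteIn⇒strip a b iw)) (suc b) (s≤s z≤n) (proj₂ (whiteIn⇒strip a b iw))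
    decode-sound e | false = sym (≢true⇒≡false λ h → unmatched-by-len h)
      where
      unmatched-by-len : matchingOf len e ≡ true → ⊥
      unmatched-by-len h with matchingOf⇒ len e h
      ... | a , b , refl , iw = true≢false (trans (sym (matched-matchDir a b iw)) eq)

  decode : PM H → Ideal
  decode M = Decode.decoded M

  decode≈ : ∀ M e → mat M e ≡ matchingOf (Ideal.len (decode M)) e
  decode≈ M = Decode.decode-sound M

  vertical-matched : ∀ C i → i < m → matchingOf (Ideal.len C) (edge (+ suc (suc i)) (+ suc (Ideal.len C (suc i))) d3) ≡ true
  vertical-matched C i i<m =
    matchingOf-intro c (suc i) (c (suc i)) d3 (whiteIn-row i (c (suc i)) (ρ-pos i i<m) (len≤ρ C i)) (matchDir-d3 (c (suc i)) (c (suc (suc i))) (suc (c (suc i))) refl)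
    where c = Ideal.len C

  vertical-matched⇒ : ∀ C i j → matchingOf (Ideal.len C) (edge (+ suc (suc i)) (+ suc j) d3) ≡ true → j ≡ Ideal.len C (suc i)
  vertical-matched⇒ C i j h = suc-injective (matchDir≡d3⇒ (c (suc i)) (c (suc (suc i))) (suc j) (matchingOf-dir c (suc i) j d3 h))
    where c = Ideal.len C

  matchingOf-injective : ∀ C C′ → (∀ e → matchingOf (Ideal.len C) e ≡ matchingOf (Ideal.len C′) e) → C ≈ᴵ C′
  matchingOf-injective C C′ h zero = trans (len-base C) (sym (len-base C′))
  matchingOf-injective C C′ h (suc i) with i <? m
  ... | yes i<m = vertical-matched⇒ C′ i (Ideal.len C (suc i)) (trans (sym (h (edge (+ suc (suc i)) (+ suc (Ideal.len C (suc i))) d3))) (vertical-matched C i i<m))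
  ... | no n = trans (len-beyond C i n) (sym (len-beyond C′ i n))

  matchingOf-cong : ∀ C C′ → C ≈ᴵ C′ → ∀ e → matchingOf (Ideal.len C) e ≡ matchingOf (Ideal.len C′) e
  matchingOf-cong C C′ h (edge (+ suc a) (+ suc b) d) rewrite h a | h (suc a) = refl
  matchingOf-cong C C′ h (edge (+ suc a) (+ zero) d) = refl
  matchingOf-cong C C′ h (edge (+ suc a) -[1+ _ ] d) = refl
  matchingOf-cong C C′ h (edge (+ zero) _ d) = refl
  matchingOf-cong C C′ h (edge -[1+ _ ] _ d) = refl

  decode-toMatching : ∀ C → decode (toMatching C) ≈ᴵ C
  decode-toMatching C = matchingOf-injective (decode (toMatching C)) C (λ e → sym (decode≈ (toMatching C) e))

  -- Arcs of Z⃗(H) remove one hexagon from the ideal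

  Lowering : Ideal → Ideal → Set
  Lowering C1 C2 = Σ ℕ λ a → Σ ℕ λ b → a < m × Ideal.len C1 (suc a) ≡ suc b × Ideal.len C1 (suc (suc a)) ≤ b ×
    Ideal.len C2 (suc a) ≡ b × (∀ k → (k ≡ suc a → ⊥) → Ideal.len C2 k ≡ Ideal.len C1 k)

  matchingOf⇒coords : ∀ c A B d → matchingOf c (edge A B d) ≡ true → Σ ℕ λ a → Σ ℕ λ b → A ≡ + suc a × B ≡ + suc b
  matchingOf⇒coords c (+ suc a) (+ suc b) d h = a , b , refl , refl

  d3∈hex⇒ : ∀ {A B X Y} → edge X Y d3 ∈ hexEdges A B → X ≡ A +ℤ + 1
  d3∈hex⇒ (there (here refl)) = refl
  d3∈hex⇒ (there (there (there (there (here refl))))) = refl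
  d3∈hex⇒ (here ())
  d3∈hex⇒ (there (there (here ())))
  d3∈hex⇒ (there (there (there (here ()))))
  d3∈hex⇒ (there (there (there (there (there (here ()))))))
  d3∈hex⇒ (there (there (there (there (there (there ()))))))

  -- M1 contains the right vertical edge of the hexagon and M2 its left one, so row a+1 drops
  -- from b+1 to b; every other vertical edge lies in both.
  arc⇒lowering : ∀ (M1 M2 : PM H) → Arc M1 M2 → Lowering (decode M1) (decode M2)
  arc⇒lowering M1 M2 (A , B , ((p12 ∷ p23 ∷ p34 ∷ p45 ∷ p56 ∷ p61 ∷ []) , (q1 ∷ q2 ∷ q3 ∷ q4 ∷ q5 ∷ q6 ∷ [])) , sd)
    with matchingOf⇒coords (Ideal.len (decode M1)) A B d2 (trans (sym (decode≈ M1 _)) (alternate-true (blackTail⇒unmatched q3) p34))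
  ... | a , b , refl , refl = a , b , a<m , e2c , e6c , e5c , rest
    where
    c1 = Ideal.len (decode M1)
    c2 = Ideal.len (decode M2)
    h2 : matchingOf c1 (edge (+ suc (suc a)) (+ suc (suc b)) d3) ≡ true
    h2 = trans (sym (decode≈ M1 _)) (subst₂ (λ X Y → mat M1 (edge X Y d3) ≡ true) (+n+1 (suc a)) (+n+1 (suc b)) (alternate-true (blackTail⇒unmatched q1) p12))
    a<m : a < m
    a<m = ρ-pos⇒< a (proj₁ (whiteIn-row⇒ a (suc b) (∧-true⇒ˡ _ _ h2)))
    e2c : c1 (suc a) ≡ suc b
    e2c = sym (vertical-matched⇒ (decode M1) a (suc b) h2)
    h6 : matchingOf c1 (edge (+ suc (suc a)) (+ suc b) d1) ≡ true
    h6 = trans (sym (decode≈ M1 _)) (subst (λ X → mat M1 (edge X (+ suc b) d1) ≡ true) (+n+1 (suc a)) (alternate-true (blackTail⇒unmatched q5) p56))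
    e6c : c1 (suc (suc a)) ≤ b
    e6c = ≤-pred (proj₁ (matchDir≡d1⇒ (c1 (suc a)) (c1 (suc (suc a))) (suc b) (matchingOf-dir c1 (suc a) b d1 h6)))
    h5 : mat M1 (edge (+ suc (suc a)) (+ suc b) d3) ≡ false
    h5 = subst (λ X → mat M1 (edge X (+ suc b) d3) ≡ false) (+n+1 (suc a)) (blackTail⇒unmatched q5)
    mem5 : edge (+ suc (suc a)) (+ suc b) d3 ∈ hexEdges (+ suc a) (+ suc b)
    mem5 = ∈hex-left a (suc b)
    h5′ : mat M2 (edge (+ suc (suc a)) (+ suc b) d3) ≡ true
    h5′ = subst (λ z → (z xor mat M2 _) ≡ true) h5 (proj₂ (sd _) mem5)
    e5c : c2 (suc a) ≡ b
    e5c = sym (vertical-matched⇒ (decode M2) a b (trans (sym (decode≈ M2 _)) h5′))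
    rest : ∀ k → (k ≡ suc a → ⊥) → c2 k ≡ c1 k
    rest zero _ = trans (len-base (decode M2)) (sym (len-base (decode M1)))
    rest (suc i) ne = row (i <? m)
      where
      row : Dec (i < m) → c2 (suc i) ≡ c1 (suc i)
      row (no n) = trans (len-beyond (decode M2) i n) (sym (len-beyond (decode M1) i n))
      row (yes i<m) = sym (vertical-matched⇒ (decode M2) i (c1 (suc i)) (trans (sym (decode≈ M2 _)) t2))
        where
        v = edge (+ suc (suc i)) (+ suc (c1 (suc i))) d3
        t1 : mat M1 v ≡ true
        t1 = trans (decode≈ M1 v) (vertical-matched (decode M1) i i<m)
        t2 : mat M2 v ≡ true
        t2 with mat M2 v in eq
        ... | true = refl
        ... | false = ⊥-elim (ne (cong suc (cong (λ { (+ suc (suc z)) → z ; _ → 0 })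
                (trans (d3∈hex⇒ (proj₁ (sd v) (subst₂ (λ x y → (x xor y) ≡ true) (sym t1) (sym eq) refl))) (+n+1 (suc a))))))

  module LowerArc (C : Ideal) (a b : ℕ) (cs : Ideal.len C (suc a) ≡ suc b) (cq : Ideal.len C (suc (suc a)) ≤ b) (a<m : a < m) where
    c = Ideal.len C
    C″ = lowerRow C a b cs cq
    c″ = Ideal.len C″

    lowered-below : c″ a ≡ c a
    lowered-below = setAt-other c a b a (1+n≢n ∘ sym)
    lowered-row : c″ (suc a) ≡ b
    lowered-row = setAt-same c a b
    lowered-above : c″ (suc (suc a)) ≡ c (suc (suc a))
    lowered-above = setAt-other c a b (suc (suc a)) 1+n≢n

    b<len-a : suc b ≤ c a
    b<len-a = subst (_≤ c a) cs (len-suc≤ C a)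

    white-upperRight : whiteIn (suc (suc a)) (suc (suc b)) ≡ true
    white-upperRight = whiteIn-row a (suc b) (ρ-pos a a<m) (subst (_≤ ρ a) cs (len≤ρ C a))
    white-upperLeft : whiteIn (suc (suc a)) (suc b) ≡ true
    white-upperLeft = whiteIn-row a b (ρ-pos a a<m) (≤-trans (n≤1+n b) (subst (_≤ ρ a) cs (len≤ρ C a)))
    white-bottom : whiteIn (suc a) (suc b) ≡ true
    white-bottom = lem a cs
      where
      lem : ∀ a → c (suc a) ≡ suc b → whiteIn (suc a) (suc b) ≡ true
      lem zero e = whiteIn-first b (subst (_≤ ρ 0) e (len≤ρ C 0))
      lem (suc i) e = whiteIn-row i b (≤-trans (s≤s z≤n) (≤-trans (subst (_≤ ρ (suc i)) e (len≤ρ C (suc i))) (ρ-suc≤ i)))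
                              (≤-trans (n≤1+n b) (≤-trans (subst (_≤ ρ (suc i)) e (len≤ρ C (suc i))) (ρ-suc≤ i)))

    -- E i and F i: the i-th clockwise edge of hexagon (a+1, b+1) in the matchings of C and C″.
    E1 : matchingOf c (edge (+ suc (suc a)) (+ suc (suc b)) d2) ≡ false
    E1 = matchingOf-false c (suc a) (suc b) d2 (suc b) (c (suc (suc a))) cs refl (λ e → d3≢d2 (trans (sym (matchDir-d3 (suc b) (c (suc (suc a))) (suc (suc b)) refl)) e))
    E2 : matchingOf c (edge (+ suc (suc a)) (+ suc (suc b)) d3) ≡ true
    E2 = matchingOf-intro′ c (suc a) (suc b) d3 (suc b) (c (suc (suc a))) cs refl white-upperRight (matchDir-d3 (suc b) (c (suc (suc a))) (suc (suc b)) refl)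
    E3 : matchingOf c (edge (+ suc a) (+ suc b) d1) ≡ false
    E3 = matchingOf-false c a b d1 (c a) (suc b) refl cs (λ e → 1+n≰n (proj₁ (matchDir≡d1⇒ (c a) (suc b) (suc b) e)))
    E4 : matchingOf c (edge (+ suc a) (+ suc b) d2) ≡ true
    E4 = matchingOf-intro′ c a b d2 (c a) (suc b) refl cs white-bottom (matchDir-d2-low (c a) (suc b) (suc b) ≤-refl b<len-a)
    E5 : matchingOf c (edge (+ suc (suc a)) (+ suc b) d3) ≡ false
    E5 = matchingOf-false c (suc a) b d3 (suc b) (c (suc (suc a))) cs refl
      (λ e → 1+n≰n (≤-reflexive (sym (suc-injective (matchDir≡d3⇒ (suc b) (c (suc (suc a))) (suc b) e)))))
    E6 : matchingOf c (edge (+ suc (suc a)) (+ suc b) d1) ≡ true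
    E6 = matchingOf-intro′ c (suc a) b d1 (suc b) (c (suc (suc a))) cs refl white-upperLeft (matchDir-d1 (suc b) (c (suc (suc a))) (suc b) (s≤s cq) ≤-refl)

    F1 : matchingOf c″ (edge (+ suc (suc a)) (+ suc (suc b)) d2) ≡ true
    F1 = matchingOf-intro′ c″ (suc a) (suc b) d2 b (c (suc (suc a))) lowered-row lowered-above white-upperRight (matchDir-d2-high b (c (suc (suc a))) (suc (suc b)) ≤-refl)
    F2 : matchingOf c″ (edge (+ suc (suc a)) (+ suc (suc b)) d3) ≡ false
    F2 = matchingOf-false c″ (suc a) (suc b) d3 b (c (suc (suc a))) lowered-row lowered-above
      (λ e → d2≢d3 (trans (sym (matchDir-d2-high b (c (suc (suc a))) (suc (suc b)) ≤-refl)) e))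
    F3 : matchingOf c″ (edge (+ suc a) (+ suc b) d1) ≡ true
    F3 = matchingOf-intro′ c″ a b d1 (c a) b lowered-below lowered-row white-bottom (matchDir-d1 (c a) b (suc b) ≤-refl b<len-a)
    F4 : matchingOf c″ (edge (+ suc a) (+ suc b) d2) ≡ false
    F4 = matchingOf-false c″ a b d2 (c a) b lowered-below lowered-row (λ e → d1≢d2 (trans (sym (matchDir-d1 (c a) b (suc b) ≤-refl b<len-a)) e))
    F5 : matchingOf c″ (edge (+ suc (suc a)) (+ suc b) d3) ≡ true
    F5 = matchingOf-intro′ c″ (suc a) b d3 b (c (suc (suc a))) lowered-row lowered-above white-upperLeft (matchDir-d3 b (c (suc (suc a))) (suc b) refl)
    F6 : matchingOf c″ (edge (+ suc (suc a)) (+ suc b) d1) ≡ false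
    F6 = matchingOf-false c″ (suc a) b d1 b (c (suc (suc a))) lowered-row lowered-above (λ e → d3≢d1 (trans (sym (matchDir-d3 b (c (suc (suc a))) (suc b) refl)) e))

    alternates₀₁ : ∀ {x y : Bool} → x ≡ false → y ≡ true → x ≡ y → ⊥
    alternates₀₁ refl refl ()
    alternates₁₀ : ∀ {x y : Bool} → x ≡ true → y ≡ false → x ≡ y → ⊥
    alternates₁₀ refl refl ()
    unmatched-vacuous : ∀ {x : Bool} → x ≡ false → x ≡ true → false ≡ true
    unmatched-vacuous refl ()

    alternating : ProperAlternatingHex (matchingOf c) (+ suc a) (+ suc b)
    alternating rewrite +-comm a 1 | +-comm b 1 =
      (alternates₀₁ E1 E2 ∷ alternates₁₀ E2 E3 ∷ alternates₀₁ E3 E4 ∷ alternates₁₀ E4 E5 ∷ alternates₀₁ E5 E6 ∷ alternates₁₀ E6 E1 ∷ []) ,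
      (unmatched-vacuous E1 ∷ (λ _ → refl) ∷ unmatched-vacuous E3 ∷ (λ _ → refl) ∷ unmatched-vacuous E5 ∷ (λ _ → refl) ∷ [])

    hexEdges-explicit : hexEdges (+ suc a) (+ suc b) ≡
      (edge (+ suc (suc a)) (+ suc (suc b)) d2 ∷ edge (+ suc (suc a)) (+ suc (suc b)) d3 ∷ edge (+ suc a) (+ suc b) d1 ∷
       edge (+ suc a) (+ suc b) d2 ∷ edge (+ suc (suc a)) (+ suc b) d3 ∷ edge (+ suc (suc a)) (+ suc b) d1 ∷ [])
    hexEdges-explicit rewrite +-comm a 1 | +-comm b 1 = refl

    Differs : Edge → Set
    Differs e = (matchingOf c e xor matchingOf c″ e) ≡ true

    hexEdge⇒differs : ∀ e → e ∈ hexEdges (+ suc a) (+ suc b) → Differs e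
    hexEdge⇒differs e mem = listed e (subst (e ∈_) hexEdges-explicit mem)
      where
      listed : ∀ e → e ∈ (edge (+ suc (suc a)) (+ suc (suc b)) d2 ∷ edge (+ suc (suc a)) (+ suc (suc b)) d3 ∷ edge (+ suc a) (+ suc b) d1 ∷
       edge (+ suc a) (+ suc b) d2 ∷ edge (+ suc (suc a)) (+ suc b) d3 ∷ edge (+ suc (suc a)) (+ suc b) d1 ∷ []) → Differs e
      listed _ (here refl) rewrite E1 | F1 = refl
      listed _ (there (here refl)) rewrite E2 | F2 = refl
      listed _ (there (there (here refl))) rewrite E3 | F3 = refl
      listed _ (there (there (there (here refl)))) rewrite E4 | F4 = refl
      listed _ (there (there (there (there (here refl))))) rewrite E5 | F5 = refl
      listed _ (there (there (there (there (there (here refl)))))) rewrite E6 | F6 = refl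

    matchingOf-sameDir : ∀ x y d → matchDir (c x) (c (suc x)) (suc y) ≡ matchDir (c″ x) (c″ (suc x)) (suc y) →
      matchingOf c (edge (+ suc x) (+ suc y) d) ≡ matchingOf c″ (edge (+ suc x) (+ suc y) d)
    matchingOf-sameDir x y d eq = cong (λ z → whiteIn (suc x) (suc y) ∧ sameDir z d) eq

    dir-changes : ∀ x y d → Differs (edge (+ suc x) (+ suc y) d) →
      matchDir (c x) (c (suc x)) (suc y) ≢ matchDir (c″ x) (c″ (suc x)) (suc y)
    dir-changes x y d h eq = xor-ne h (matchingOf-sameDir x y d eq)

    differs-strip-a : ∀ y d → Differs (edge (+ suc a) (+ suc y) d) → edge (+ suc a) (+ suc y) d ∈ hexEdges (+ suc a) (+ suc b)
    differs-strip-a y d h = at-b (suc-injective (matchDir-shrinkUpper (c a) b (suc y) b<len-a changes)) h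
      where
      changes : matchDir (c a) (suc b) (suc y) ≢ matchDir (c a) b (suc y)
      changes eq = dir-changes a y d h
        (trans (cong (λ z → matchDir (c a) z (suc y)) cs) (trans eq (sym (cong₂ (λ u v → matchDir u v (suc y)) lowered-below lowered-row))))
      at-b : y ≡ b → Differs (edge (+ suc a) (+ suc y) d) → edge (+ suc a) (+ suc y) d ∈ hexEdges (+ suc a) (+ suc b)
      at-b refl h with xor-split h
      ... | inj₁ h1 = subst (λ z → edge (+ suc a) (+ suc b) z ∈ hexEdges (+ suc a) (+ suc b))
                (trans (sym (matchDir-d2-low (c a) (c (suc a)) (suc b) (≤-reflexive (sym cs)) (len-suc≤ C a))) (matchingOf-dir c a b d h1))
                (∈hex-lowerLeft a (suc b))
      ... | inj₂ h2 = subst (λ z → edge (+ suc a) (+ suc b) z ∈ hexEdges (+ suc a) (+ suc b))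
                (trans (sym (subst₂ (λ u v → matchDir u v (suc b) ≡ d1) (sym lowered-below) (sym lowered-row) (matchDir-d1 (c a) b (suc b) ≤-refl b<len-a)))
                  (matchingOf-dir c″ a b d h2))
                (∈hex-lowerRight a (suc b))

    differs-strip-suc-a : ∀ y d → Differs (edge (+ suc (suc a)) (+ suc y) d) → edge (+ suc (suc a)) (+ suc y) d ∈ hexEdges (+ suc a) (+ suc b)
    differs-strip-suc-a y d h = at (matchDir-shrinkLower b q (suc y) cq changes) h
      where
      q = c (suc (suc a))
      changes : matchDir (suc b) q (suc y) ≢ matchDir b q (suc y)
      changes eq = dir-changes (suc a) y d h
        (trans (cong (λ z → matchDir z q (suc y)) cs) (trans eq (sym (cong₂ (λ u v → matchDir u v (suc y)) lowered-row lowered-above))))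
      before : ∀ Y d → matchDir (c (suc a)) q Y ≡ d → matchDir (suc b) q Y ≡ d
      before Y d e = trans (cong (λ z → matchDir z q Y) (sym cs)) e
      after : ∀ Y d → matchDir (c″ (suc a)) (c″ (suc (suc a))) Y ≡ d → matchDir b q Y ≡ d
      after Y d e = trans (cong₂ (λ u v → matchDir u v Y) (sym lowered-row) (sym lowered-above)) e
      at : suc y ≡ suc b ⊎ suc y ≡ suc (suc b) → Differs (edge (+ suc (suc a)) (+ suc y) d) →
        edge (+ suc (suc a)) (+ suc y) d ∈ hexEdges (+ suc a) (+ suc b)
      at (inj₁ refl) h with xor-split h
      ... | inj₁ h1 = subst (λ z → edge (+ suc (suc a)) (+ suc b) z ∈ hexEdges (+ suc a) (+ suc b))
                (trans (sym (matchDir-d1 (suc b) q (suc b) (s≤s cq) ≤-refl)) (before (suc b) d (matchingOf-dir c (suc a) b d h1)))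
                (∈hex-upperLeft a (suc b))
      ... | inj₂ h2 = subst (λ z → edge (+ suc (suc a)) (+ suc b) z ∈ hexEdges (+ suc a) (+ suc b))
                (trans (sym (matchDir-d3 b q (suc b) refl)) (after (suc b) d (matchingOf-dir c″ (suc a) b d h2)))
                (∈hex-left a (suc b))
      at (inj₂ refl) h with xor-split h
      ... | inj₁ h1 = subst (λ z → edge (+ suc (suc a)) (+ suc (suc b)) z ∈ hexEdges (+ suc a) (+ suc b))
                (trans (sym (matchDir-d3 (suc b) q (suc (suc b)) refl)) (before (suc (suc b)) d (matchingOf-dir c (suc a) (suc b) d h1)))
                (∈hex-right a (suc b))
      ... | inj₂ h2 = subst (λ z → edge (+ suc (suc a)) (+ suc (suc b)) z ∈ hexEdges (+ suc a) (+ suc b))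
                (trans (sym (matchDir-d2-high b q (suc (suc b)) ≤-refl)) (after (suc (suc b)) d (matchingOf-dir c″ (suc a) (suc b) d h2)))
                (∈hex-upperRight a (suc b))

    -- Only strips a and a+1 read row a+1, and there the matched directions change only next to
    -- the hexagon (matchDir-shrinkUpper / matchDir-shrinkLower).
    differs⇒hexEdge : ∀ e → Differs e → e ∈ hexEdges (+ suc a) (+ suc b)
    differs⇒hexEdge (edge (+ suc x) (+ suc y) d) h = strip (x ≟ a) (x ≟ suc a)
      where
      strip : Dec (x ≡ a) → Dec (x ≡ suc a) → edge (+ suc x) (+ suc y) d ∈ hexEdges (+ suc a) (+ suc b)
      strip (yes refl) _ = differs-strip-a y d h
      strip (no _) (yes refl) = differs-strip-suc-a y d h
      strip (no ne₁) (no ne₂) =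
        ⊥-elim (xor-ne h (matchingOf-local c c″ x y d (sym (setAt-other c a b x ne₂)) (sym (setAt-other c a b (suc x) (ne₁ ∘ suc-injective)))))
    differs⇒hexEdge (edge (+ suc x) (+ zero) d) ()
    differs⇒hexEdge (edge (+ suc x) -[1+ _ ] d) ()
    differs⇒hexEdge (edge (+ zero) _ d) ()
    differs⇒hexEdge (edge -[1+ _ ] _ d) ()

    lowerRow-arc : Arc (toMatching C) (toMatching C″)
    lowerRow-arc = + suc a , + suc b , alternating , λ e → differs⇒hexEdge e , hexEdge⇒differs e

  -- 𝐌(H) is isomorphic to the lattice of ideals

  ≈⇒decode≈ᴵ : ∀ (x y : PM H) → x ≈M y → decode x ≈ᴵ decode y
  ≈⇒decode≈ᴵ x y eq = matchingOf-injective (decode x) (decode y) (λ e → trans (sym (decode≈ x e)) (trans (eq e) (decode≈ y e)))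

  star⇒decode≥ : ∀ {u v : PM H} → Star Step u v → decode v ≤ᴵ decode u
  star⇒decode≥ ε k = ≤-refl
  star⇒decode≥ {u} (inj₁ eq ◅ rest) k = ≤-trans (star⇒decode≥ rest k) (≤-reflexive (sym (≈⇒decode≈ᴵ u _ eq k)))
  star⇒decode≥ {u} (inj₂ step ◅ rest) k = ≤-trans (star⇒decode≥ rest k) (lowered k)
    where
    lowered : ∀ k → Ideal.len (decode _) k ≤ Ideal.len (decode u) k
    lowered k with arc⇒lowering u _ step
    ... | a , b , _ , e1 , _ , e2 , oth with k ≟ suc a
    ...   | yes refl = subst₂ _≤_ (sym e2) (sym e1) (n≤1+n b)
    ...   | no ne = ≤-reflexive (oth k ne)

  toMatching-decode : ∀ x → toMatching (decode x) ≈M x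
  toMatching-decode x e = sym (decode≈ x e)

  ⪯⇒≤ᴵ : ∀ {C C′} → toMatching C ⪯M toMatching C′ → C ≤ᴵ C′
  ⪯⇒≤ᴵ {C} {C′} h k = subst₂ _≤_ (decode-toMatching C k) (decode-toMatching C′ k) (star⇒decode≥ h k)

  -- Induction on the size of C′ (the sum of its row lengths): each arc removes one hexagon.
  lowering-path : ∀ n (C C′ : Ideal) → sumTo m (Ideal.len C′) ≡ n → C ≤ᴵ C′ → Star Step (toMatching C′) (toMatching C)
  lowering-path n C C′ sn le with topmostDifference C C′ le m (agree-beyond C C′)
  ... | inj₁ eq = inj₁ (λ e → sym (matchingOf-cong C C′ eq e)) ◅ ε
  ... | inj₂ (a , lt , top) = step n sn
    where
    c = Ideal.len C
    c′ = Ideal.len C′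
    b = pred (c′ (suc a))
    cs : c′ (suc a) ≡ suc b
    cs = sym (suc-pred (c′ (suc a)) {{>-nonZero (≤-trans (s≤s z≤n) lt)}})
    cq : c′ (suc (suc a)) ≤ b
    cq = ≤-pred (subst (c′ (suc (suc a)) <_) cs (subst (_< c′ (suc a)) (top (suc (suc a)) ≤-refl) (≤-<-trans (len-suc≤ C (suc a)) lt)))
    a<m : a < m
    a<m = ρ-pos⇒< a (≤-trans (s≤s z≤n) (≤-trans (subst (suc b ≤_) (sym cs) ≤-refl) (len≤ρ C′ a)))
    C″ = lowerRow C′ a b cs cq
    le″ : C ≤ᴵ C″
    le″ = ≤ᴵ-lowerRow {C} C′ a b cs cq le (≤-pred (subst (c (suc a) <_) cs lt))
    sum″ : sumTo m c′ ≡ suc (sumTo m (Ideal.len C″))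
    sum″ = sumTo-decrement m c′ (Ideal.len C″) (suc a) (s≤s z≤n) a<m (trans cs (cong suc (sym (setAt-same c′ a b)))) (λ k ne → sym (setAt-other c′ a b k ne))
    step : ∀ n → sumTo m c′ ≡ n → Star Step (toMatching C′) (toMatching C)
    step zero e = ⊥-elim (1+n≢0 (trans (sym sum″) e))
    step (suc n′) e = inj₂ (LowerArc.lowerRow-arc C′ a b cs cq a<m) ◅ lowering-path n′ C C″ (suc-injective (trans (sym sum″) e)) le″

  ≤ᴵ⇒⪯ : ∀ {C C′} → C ≤ᴵ C′ → toMatching C ⪯M toMatching C′
  ≤ᴵ⇒⪯ {C} {C′} = lowering-path _ C C′ refl

  open OrderEquivalence {_≈ᴬ_ = _≈ᴵ_} {_≤ᴬ_ = _≤ᴵ_} {_≈ᴮ_ = _≈M_ {H}} {_≤ᴮ_ = _⪯M_ {H}}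
    toMatching decode ≤ᴵ⇒⪯ ⪯⇒≤ᴵ (λ {C} {C′} → matchingOf-cong C C′) (λ {C} {C′} → matchingOf-injective C C′) toMatching-decode
    (λ eq e → sym (eq e)) (λ eq eq′ e → trans (eq e) (eq′ e)) (λ eq → inj₁ (λ e → sym (eq e)) ◅ ε) (λ xy yz → yz ◅◅ xy)
    public

lemma4p5 : (m : ℕ) (r : Fin m → ℕ) →
    (∀ i k → toℕ i ≤ toℕ k → r k ≤ r i) →
    (∀ i → 1 ≤ r i) →
    Σ (FElem m r → PM (L m r)) λ f →
    (∀ h → JoinIrreducibleM (f h)) ×
    (∀ x → JoinIrreducibleM x → Σ (FElem m r) λ h → f h ≈M x) ×
    (∀ h h′ → (h ⪯F h′ → f h ⪯M f h′) × (f h ⪯M f h′ → h ⪯F h′))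
lemma4p5 m r antitone positive =
  toMatching ∘ hexagonIdeal ,
  (λ h → to-joinIrreducible (hexagonIdeal-joinIrreducible h)) ,
  (λ x ji → let h , h≈ = joinIrreducible⇒hexagonIdeal (decode x) (from-joinIrreducible ji)
            in h , λ e → trans (matchingOf-cong (hexagonIdeal h) (decode x) h≈ e) (toMatching-decode x e)) ,
  (λ h h′ → ≤ᴵ⇒⪯ ∘ Equivalence.from (hexagonIdeal-≤ᴵ-iff h h′) , Equivalence.to (hexagonIdeal-≤ᴵ-iff h h′) ∘ ⪯⇒≤ᴵ)
  where open TruncatedParallelogram m r antitone positive
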